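{- For every $s\in\{0,\dots,n\}$, the restriction of the edge labeling $\lambda$ to the cover relations of the subposet $P_{n,s}\subseteq\Pi_n^B$ is an EL-labeling of $P_{n,s}$ (the intersection lattice of $\mathcal D_{n,s}$).
   Context: $\Pi_n^B$ is the set of partitions $\pi$ of $\{ -n,\dots,n\}$ such that (1) $B\in\pi$ implies $-B\in\pi$, and (2) if $i,-i\in B$ for some $i$ and some block $B$, then $0\in B$; ordered by refinement ($x\preceq y$ iff each block of $x$ lies in a block of $y$), graded by $r(\pi)=n-(|\pi|-1)/2$. It is isomorphic to the intersection lattice of the arrangement $\mathcal B_n$. The zero block $x_0$ of $x$ is the block containing $0$. $P_{n,s}$ is the subposet of all $\pi\in\Pi_n^B$ having no block equal to $\{k,0,-k\}$ for any $k\in\{s+1,\dots,n\}$, with the restricted rank function; it is isomorphic to the intersection lattice of $\mathcal D_{n,s}$ (normals $e_i\pm e_j$, $i<j$, and $e_i$, $i\le s$). For a block $R$, its representative $r(R)$ is the least $i\in[n]$ with $i\in R$ or $-i\in R$; $R$ is normalized if $r(R)\in R$. A cover relation $x\prec\!\!\cdot\,y$ is signed if $x_0\subsetneq y_0$; coherent if $R\cup R'\in y$ for some distinct normalized non-zero blocks $R,R'\in x$; non-coherent if $R\cup(-R')\in y$ for some distinct normalized non-zero blocks $R,R'\in x$. The labeling: if $x\prec\!\!\cdot\,y$ is unsigned with merged blocks $R,R'\in x$ having representatives $i,j$, then $\lambda(x,y)=(0,\max(i,j))$ if coherent and $(2,\min(i,j))$ if non-coherent; if signed, $\lambda(x,y)=(1,1)$.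 Labels are ordered lexicographically. A maximal chain of an interval is increasing if its label sequence is strictly increasing. An EL-labeling of a bounded ranked poset is an edge labeling such that every closed interval $[x,y]$ has a unique increasing maximal chain, and this chain's label sequence lexicographically precedes that of every other maximal chain of $[x,y]$. -}

module Defs where

open import Data.Nat using (ℕ; zero; suc; _<_; _≤_; _<ᵇ_; _⊔_; _⊓_)
open import Data.Fin using (Fin; toℕ)
open import Data.Bool using (Bool; true; false; not; _∧_; _∨_; if_then_else_; T)
open import Data.List using (List; []; _∷_; _++_; map; allFin; cartesianProduct)
open import Data.Bool.ListAction using (any; all)
open import Data.List.Relation.Unary.Linked using (Linked)
open import Data.Product using (_×_; _,_; Σ; ∃)
open import Data.Sum using (_⊎_)
open import Data.Empty using (⊥)
open import Data.Unit using (⊤)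
open import Relation.Nullary using (¬_)
open import Relation.Binary.PropositionalEquality using (_≡_)

-- The ground set {-n, ..., n}.
-- zer = 0, pos i = i+1, neg i = -(i+1)   (i : Fin n, so i+1 ∈ [n])

data Elt (n : ℕ) : Set where
  zer : Elt n
  pos : Fin n → Elt n
  neg : Fin n → Elt n

negE : ∀ {n} → Elt n → Elt n
negE zer     = zer
negE (pos i) = neg i
negE (neg i) = pos i

allElt : ∀ n → List (Elt n)
allElt n = zer ∷ (map pos (allFin n) ++ map neg (allFin n))

-- Elements of Π_n^B: a partition of {-n..n} given by its (decidable)
-- equivalence relation "a and b lie in the same block".
--   negClosed : B ∈ π ⇒ -B ∈ π
--   zeroCond  : i, -i in the same block ⇒ 0 in that block

record Part (n : ℕ) : Set where
  field
    rel       : Elt n → Elt n → Bool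
    reflR     : ∀ a → T (rel a a)
    symR      : ∀ a b → T (rel a b) → T (rel b a)
    transR    : ∀ a b c → T (rel a b) → T (rel b c) → T (rel a c)
    negClosed : ∀ a b → T (rel a b) → T (rel (negE a) (negE b))
    zeroCond  : ∀ i → T (rel (pos i) (neg i)) → T (rel zer (pos i))
open Part public

_≼_ : ∀ {n} → Part n → Part n → Set
x ≼ y = ∀ a b → T (rel x a b) → T (rel y a b)

_≈_ : ∀ {n} → Part n → Part n → Set
x ≈ y = (x ≼ y) × (y ≼ x)

_≺_ : ∀ {n} → Part n → Part n → Set
x ≺ y = (x ≼ y) × ¬ (y ≼ x)

IsBlock : ∀ {n} → Part n → (Elt n → Set) → Set
IsBlock {n} x S = Σ (Elt n) λ a → ∀ e → (T (rel x a e) → S e) × (S e → T (rel x a e))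

-- membership in P_{n,s}: no block equal to {k,0,-k} for k ∈ {s+1..n}
-- (k = toℕ i + 1, so k ≥ s+1  iff  s ≤ toℕ i)
InP : ∀ {n} → ℕ → Part n → Set
InP {n} s x = ∀ (i : Fin n) → s ≤ toℕ i →
  ¬ IsBlock x (λ e → (e ≡ pos i) ⊎ (e ≡ zer) ⊎ (e ≡ neg i))

CoverP : ∀ {n} → ℕ → Part n → Part n → Set
CoverP {n} s x y = (x ≺ y) ×
  (∀ (z : Part n) → InP s z → x ≼ z → z ≼ y → (z ≈ x) ⊎ (z ≈ y))

Label : Set
Label = ℕ × ℕ

_<L_ : Label → Label → Set
(a , b) <L (c , d) = (a < c) ⊎ ((a ≡ c) × (b < d))

signedᵇ : ∀ {n} → Part n → Part n → Bool
signedᵇ {n} x y = any (λ e → rel y zer e ∧ not (rel x zer e)) (allElt n)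

-- i+1 is the representative of its block in x, that block is normalized
-- (contains +(i+1)) and is a non-zero block
isNormRepᵇ : ∀ {n} → Part n → Fin n → Bool
isNormRepᵇ {n} x i =
  not (rel x zer (pos i)) ∧
  all (λ k → not (toℕ k <ᵇ toℕ i) ∨
             (not (rel x (pos k) (pos i)) ∧ not (rel x (neg k) (pos i))))
      (allFin n)

-- (i,j): representatives i+1, j+1 of distinct normalized non-zero blocks
-- R, R' of x, such that R ∪ R' or R ∪ (-R') lies in a block of y
candᵇ : ∀ {n} → Part n → Part n → Fin n → Fin n → Bool
candᵇ x y i j =
  isNormRepᵇ x i ∧ isNormRepᵇ x j ∧
  not (rel x (pos i) (pos j)) ∧ not (rel x (pos i) (neg j)) ∧
  (rel y (pos i) (pos j) ∨ rel y (pos i) (neg j))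

unsignedLabel : ∀ {n} → Part n → Part n → List (Fin n × Fin n) → Label
unsignedLabel x y [] = (0 , 0)
unsignedLabel x y ((i , j) ∷ ps) =
  if candᵇ x y i j
  then (if rel y (pos i) (pos j)
        then (0 , suc (toℕ i ⊔ toℕ j))
        else (2 , suc (toℕ i ⊓ toℕ j)))
  else unsignedLabel x y ps

lam : ∀ {n} → Part n → Part n → Label
lam {n} x y =
  if signedᵇ x y then (1 , 1)
  else unsignedLabel x y (cartesianProduct (allFin n) (allFin n))

data Chain {n : ℕ} (s : ℕ) : Part n → Part n → Set where
  done : ∀ {x y} → x ≈ y → Chain s x y
  step : ∀ {x z y} → InP s z → CoverP s x z → Chain s z y → Chain s x y

labels : ∀ {n s} {x y : Part n} → Chain s x y → List Label
labels (done _) = []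
labels (step {x = x} {z = z} _ _ c) = lam x z ∷ labels c

ChainEq : ∀ {n s} {x y x' y' : Part n} → Chain s x y → Chain s x' y' → Set
ChainEq (done _) (done _) = ⊤
ChainEq (done _) (step _ _ _) = ⊥
ChainEq (step _ _ _) (done _) = ⊥
ChainEq (step {z = z} _ _ c) (step {z = z'} _ _ c') = (z ≈ z') × ChainEq c c'

Increasing : List Label → Set
Increasing = Linked _<L_

LexLt : List Label → List Label → Set
LexLt [] [] = ⊥
LexLt [] (_ ∷ _) = ⊤
LexLt (_ ∷ _) [] = ⊥
LexLt (a ∷ as) (b ∷ bs) = (a <L b) ⊎ ((a ≡ b) × LexLt as bs)

IsELLabeling : ℕ → ℕ → Set
IsELLabeling n s =
  ∀ (x y : Part n) → InP s x → InP s y → x ≼ y →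
  Σ (Chain s x y) λ c → Increasing (labels c) ×
    (∀ (c' : Chain s x y) →
       (Increasing (labels c') → ChainEq c c') ×
       (¬ ChainEq c c' → LexLt (labels c) (labels c')))

-- A cover x ⋖ z of P_{n,s} either enlarges the zero block (signed, label (1,1)) or merges two
-- normalized non-zero blocks R, R' with representatives i < j into R ∪ R' (coherent, label
-- (0,j)) or into R ∪ -R' (non-coherent, label (2,i)); such merges stay in P_{n,s}, whose
-- definition only constrains the zero block.  In an interval [x,y] single out an atom z: the
-- coherent merge with least j if y joins two normalized blocks of x coherently; otherwise the
-- absorption of the unique pair of blocks by which the zero block of y exceeds that of x;
-- otherwise the non-coherent merge with least i.  Its label is the unique least atom label and
-- lies below the label of every atom of [z,y], while every other atom z' has an atom w of
-- [z',y] with λ(x,z') ≮ λ(z',w), so no increasing chain starts at z'.  Induction on the number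
-- of pairs of elements separated by x then gives the unique increasing maximal chain, which is
-- also lexicographically first.

module Submission where

open import Defs
open import Data.Nat using (ℕ; zero; suc; _+_; _<_; _≤_; _<ᵇ_; _⊔_; _⊓_; z≤n; s≤s)
open import Data.Nat.Properties
  using (<-irrefl; <-trans; <⇒≤; <-≤-trans; +-mono-≤; +-mono-<-≤; +-mono-≤-<;
         m⊓n≤m; m≤n⇒m⊔n≡n; m≥n⇒m⊔n≡m; m≤n⇒m⊓n≡m; m≥n⇒m⊓n≡n; <ᵇ⇒<; <⇒<ᵇ; _<?_)
open import Data.Fin using (Fin; toℕ; inject; fromℕ<)
open import Data.Fin.Properties
  using (_≟_; <-cmp; <⇒≢; toℕ-injective; toℕ-inject; toℕ-fromℕ<;
         all?; any?; ¬∀⟶∃¬; ¬∀⟶∃¬-smallest)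
open import Data.Bool using (Bool; true; false; not; _∧_; _∨_; if_then_else_; T)
open import Data.Bool.Properties using (T-∧; T-∨)
open import Data.Bool.ListAction using (or; and)
open import Data.List using (List; []; _∷_; _++_; map; allFin; cartesianProduct)
open import Data.List.Properties using (map-cong)
open import Data.List.Membership.Propositional using (_∈_; lose)
open import Data.List.Membership.Propositional.Properties
  using (∈-allFin; ∈-cartesianProduct⁺; ∈-++⁺ˡ; ∈-++⁺ʳ; ∈-map⁺)
open import Data.List.Relation.Unary.Any using (here; there; satisfied)
open import Data.List.Relation.Unary.Any.Properties using (any⁺; any⁻)
open import Data.List.Relation.Unary.All using (lookup; tabulate)
open import Data.List.Relation.Unary.All.Properties using (all⁺; all⁻)
open import Data.List.Relation.Unary.Linked using ([]; [-]; _∷_; tail)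
open import Data.Product using (_×_; _,_; Σ; ∃; ∃₂; proj₁; proj₂)
open import Data.Sum using (_⊎_; inj₁; inj₂; [_,_])
open import Data.Empty using (⊥; ⊥-elim)
open import Data.Unit using (⊤; tt)
open import Function using (_∘_)
open import Function.Bundles using (Equivalence)
open import Relation.Unary using (Decidable)
open import Relation.Nullary using (¬_; Dec; yes; no)
open import Relation.Nullary.Decidable using (T?; ¬?; _×-dec_; _→-dec_; map′; decidable-stable)
open import Relation.Binary using (tri<; tri≈; tri>)
open import Relation.Binary.PropositionalEquality
  using (_≡_; _≢_; refl; sym; trans; cong; cong₂; subst; subst₂)
open import Induction.WellFounded using (Acc; acc)
open import Data.Nat.Induction using (<-wellFounded)

∧⁻ : ∀ {a b} → T (a ∧ b) → T a × T b
∧⁻ = Equivalence.to T-∧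

∧⁺ : ∀ {a b} → T a → T b → T (a ∧ b)
∧⁺ p q = Equivalence.from T-∧ (p , q)

∨⁻ : ∀ {a b} → T (a ∨ b) → T a ⊎ T b
∨⁻ = Equivalence.to T-∨

∨⁺ˡ : ∀ {a b} → T a → T (a ∨ b)
∨⁺ˡ p = Equivalence.from T-∨ (inj₁ p)

∨⁺ʳ : ∀ {a b} → T b → T (a ∨ b)
∨⁺ʳ {a} q = Equivalence.from (T-∨ {a}) (inj₂ q)

not⁻ : ∀ {a} → T (not a) → ¬ T a
not⁻ {false} _ ()

not⁺ : ∀ {a} → ¬ T a → T (not a)
not⁺ {false} _ = tt
not⁺ {true} ¬t = ¬t tt

T-injective : ∀ {a b} → (T a → T b) → (T b → T a) → a ≡ b
T-injective {false} {false} _ _ = refl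
T-injective {false} {true} _ g = ⊥-elim (g tt)
T-injective {true} {false} f _ = ⊥-elim (f tt)
T-injective {true} {true} _ _ = refl

if-cong : ∀ {A : Set} {b b' : Bool} {p p' q q' : A} → b ≡ b' → p ≡ p' → q ≡ q' →
          (if b then p else q) ≡ (if b' then p' else q')
if-cong refl refl refl = refl

module _ {n : ℕ} where

  ∈-allElt : (e : Elt n) → e ∈ allElt n
  ∈-allElt zer = here refl
  ∈-allElt (pos i) = there (∈-++⁺ˡ (∈-map⁺ pos (∈-allFin i)))
  ∈-allElt (neg i) = there (∈-++⁺ʳ (map pos (allFin n)) (∈-map⁺ neg (∈-allFin i)))

  ∀-Elt : {P : Elt n → Set} → P zer → (∀ i → P (pos i)) → (∀ i → P (neg i)) → ∀ e → P e
  ∀-Elt p₀ p₊ p₋ zer = p₀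
  ∀-Elt p₀ p₊ p₋ (pos i) = p₊ i
  ∀-Elt p₀ p₊ p₋ (neg i) = p₋ i

  ∀-Elt? : {P : Elt n → Set} → Decidable P → Dec (∀ e → P e)
  ∀-Elt? P? = map′ (λ (p₀ , p₊ , p₋) → ∀-Elt p₀ p₊ p₋) (λ p → p zer , p ∘ pos , p ∘ neg)
                   (P? zer ×-dec all? (P? ∘ pos) ×-dec all? (P? ∘ neg))

  ¬∀-Elt⇒∃¬ : {P : Elt n → Set} → Decidable P → ¬ (∀ e → P e) → ∃ λ e → ¬ P e
  ¬∀-Elt⇒∃¬ P? ¬∀ with P? zer | all? (P? ∘ pos)
  ... | no ¬p₀ | _ = zer , ¬p₀
  ... | yes _ | no ¬p₊ = let i , ¬p = ¬∀⟶∃¬ n _ (P? ∘ pos) ¬p₊ in pos i , ¬p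
  ... | yes p₀ | yes p₊ =
    let i , ¬p = ¬∀⟶∃¬ n _ (P? ∘ neg) (λ p₋ → ¬∀ (∀-Elt p₀ p₊ p₋)) in neg i , ¬p

  leastFin : (P : Fin n → Set) → Decidable P → ∃ P → ∃ λ i → P i × (∀ k → toℕ k < toℕ i → ¬ P k)
  leastFin P P? (i₀ , p₀) with ¬∀⟶∃¬-smallest n (¬_ ∘ P) (¬? ∘ P?) (λ ¬p → ¬p i₀ p₀)
  ... | i , ¬¬p , below =
    i , decidable-stable (P? i) ¬¬p , λ k k<i → below (fromℕ< k<i) ∘ subst P (sym (inject-fromℕ< k<i))
    where
    inject-fromℕ< : ∀ {k} (k<i : toℕ k < toℕ i) → inject (fromℕ< k<i) ≡ k
    inject-fromℕ< k<i = toℕ-injective (trans (toℕ-inject (fromℕ< k<i)) (toℕ-fromℕ< k<i))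

infix 4 _∼[_]_

_∼[_]_ : ∀ {n} → Elt n → Part n → Elt n → Set
a ∼[ x ] b = T (rel x a b)

negE-involutive : ∀ {n} (a : Elt n) → negE (negE a) ≡ a
negE-involutive zer = refl
negE-involutive (pos i) = refl
negE-involutive (neg i) = refl

module _ {n} (x : Part n) where

  ∼-refl : ∀ a → a ∼[ x ] a
  ∼-refl = reflR x

  ∼-sym : ∀ {a b} → a ∼[ x ] b → b ∼[ x ] a
  ∼-sym = symR x _ _

  ∼-trans : ∀ {a b c} → a ∼[ x ] b → b ∼[ x ] c → a ∼[ x ] c
  ∼-trans = transR x _ _ _

  ∼-neg : ∀ {a b} → a ∼[ x ] b → negE a ∼[ x ] negE b
  ∼-neg = negClosed x _ _

  ∼-neg⁻ : ∀ {a b} → negE a ∼[ x ] negE b → a ∼[ x ] b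
  ∼-neg⁻ {a} {b} r = subst₂ (λ a b → a ∼[ x ] b) (negE-involutive a) (negE-involutive b) (∼-neg r)

  ∼-negˡ : ∀ {a b} → negE a ∼[ x ] b → a ∼[ x ] negE b
  ∼-negˡ {a} r = subst (λ a → a ∼[ x ] _) (negE-involutive a) (∼-neg r)

  zero-∼-neg⁻ : ∀ {a} → zer ∼[ x ] negE a → zer ∼[ x ] a
  zero-∼-neg⁻ = ∼-neg⁻ {zer}

  self-neg⇒zero : ∀ a → a ∼[ x ] negE a → zer ∼[ x ] a
  self-neg⇒zero zer r = r
  self-neg⇒zero (pos i) r = zeroCond x i r
  self-neg⇒zero (neg i) r = ∼-neg (zeroCond x i (∼-sym r))

≼-refl : ∀ {n} {x : Part n} → x ≼ x
≼-refl a b r = r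

≼-trans : ∀ {n} {x y z : Part n} → x ≼ y → y ≼ z → x ≼ z
≼-trans x≼y y≼z a b = y≼z a b ∘ x≼y a b

≈-refl : ∀ {n} {x : Part n} → x ≈ x
≈-refl {x = x} = ≼-refl {x = x} , ≼-refl {x = x}

≈-sym : ∀ {n} {x y : Part n} → x ≈ y → y ≈ x
≈-sym (p , q) = q , p

≈-trans : ∀ {n} {x y z : Part n} → x ≈ y → y ≈ z → x ≈ z
≈-trans {x = x} {y} {z} (p , q) (p' , q') = ≼-trans {x = x} {y} {z} p p' , ≼-trans {x = z} {y} {x} q' q

module _ {n} (x y : Part n) where

  inherits? : ∀ a → Dec (∀ b → a ∼[ x ] b → a ∼[ y ] b)
  inherits? a = ∀-Elt? (λ b → T? (rel x a b) →-dec T? (rel y a b))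

  inherits-or-separated : ∀ a → (∀ b → a ∼[ x ] b → a ∼[ y ] b) ⊎
                                ∃ λ b → a ∼[ x ] b × ¬ a ∼[ y ] b
  inherits-or-separated a with inherits? a
  ... | yes inherits = inj₁ inherits
  ... | no ¬inherits = let b , ¬ab = ¬∀-Elt⇒∃¬ (λ b → T? (rel x a b) →-dec T? (rel y a b)) ¬inherits
                       in inj₂ (b , separated ¬ab)
    where
    separated : ∀ {p q} → ¬ (T p → T q) → T p × ¬ T q
    separated {true} {false} _ = tt , λ ()
    separated {false} ¬pq = ⊥-elim (¬pq λ ())
    separated {true} {true} ¬pq = ⊥-elim (¬pq _)

  ≼-or-separated : x ≼ y ⊎ ∃₂ λ a b → a ∼[ x ] b × ¬ a ∼[ y ] b
  ≼-or-separated with ∀-Elt? inherits?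
  ... | yes x≼y = inj₁ x≼y
  ... | no x⋠y with ¬∀-Elt⇒∃¬ inherits? x⋠y
  ... | a , ¬inherits with inherits-or-separated a
  ... | inj₁ inherits = ⊥-elim (¬inherits inherits)
  ... | inj₂ (b , separated) = inj₂ (a , b , separated)

-- Merging blocks

UnionOfBlocks : ∀ {n} → Part n → (Elt n → Bool) → Set
UnionOfBlocks x S = ∀ {a b} → a ∼[ x ] b → T (S a) → T (S b)

SignShape : ∀ {n} → (Elt n → Bool) → Set
SignShape S = (∀ e → T (S e) → ¬ T (S (negE e))) ⊎ (T (S zer) × (∀ e → T (S e) → T (S (negE e))))

-- S is merged into one block and -S into another; under the second alternative of SignShape
-- they coincide and are absorbed into the zero block.
module Merge {n} (x : Part n) (S : Elt n → Bool) (S-closed : UnionOfBlocks x S) (S-shape : SignShape S) where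

  data Case (a b : Elt n) : Set where
    in-x : a ∼[ x ] b → Case a b
    in-S : T (S a) → T (S b) → Case a b
    in-−S : T (S (negE a)) → T (S (negE b)) → Case a b

  private
    S-neg⁻ : ∀ {e} → T (S (negE (negE e))) → T (S e)
    S-neg⁻ {e} = subst (T ∘ S) (negE-involutive e)

    S-neg⁺ : ∀ {e} → T (S e) → T (S (negE (negE e)))
    S-neg⁺ {e} = subst (T ∘ S) (sym (negE-involutive e))

    self-negating : ∀ {e} → T (S e) → T (S (negE e)) → T (S zer) × (∀ f → T (S (negE f)) → T (S f))
    self-negating {e} p q = [ (λ disjoint → ⊥-elim (disjoint e p q)) ,
                              (λ (z , sn) → z , λ f r → S-neg⁻ (sn (negE f) r)) ] S-shape

    case-sym : ∀ {a b} → Case a b → Case b a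
    case-sym (in-x r) = in-x (∼-sym x r)
    case-sym (in-S p q) = in-S q p
    case-sym (in-−S p q) = in-−S q p

    case-trans : ∀ {a b c} → Case a b → Case b c → Case a c
    case-trans (in-x r) (in-x r') = in-x (∼-trans x r r')
    case-trans (in-x r) (in-S p q) = in-S (S-closed (∼-sym x r) p) q
    case-trans (in-x r) (in-−S p q) = in-−S (S-closed (∼-neg x (∼-sym x r)) p) q
    case-trans (in-S p q) (in-x r) = in-S p (S-closed r q)
    case-trans (in-S p _) (in-S _ q) = in-S p q
    case-trans (in-S p q) (in-−S q' r) = in-S p (proj₂ (self-negating q q') _ r)
    case-trans (in-−S p q) (in-x r) = in-−S p (S-closed (∼-neg x r) q)
    case-trans (in-−S p q) (in-S q' r) = in-S (proj₂ (self-negating q' q) _ p) r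
    case-trans (in-−S p _) (in-−S _ q) = in-−S p q

    case-neg : ∀ {a b} → Case a b → Case (negE a) (negE b)
    case-neg (in-x r) = in-x (∼-neg x r)
    case-neg (in-S p q) = in-−S (S-neg⁺ p) (S-neg⁺ q)
    case-neg (in-−S p q) = in-S p q

    case-zero : ∀ {i} → Case (pos i) (neg i) → Case zer (pos i)
    case-zero {i} (in-x r) = in-x (zeroCond x i r)
    case-zero (in-S p q) = in-S (proj₁ (self-negating p q)) p
    case-zero (in-−S p q) = in-S (proj₁ (self-negating q p)) q

    mrel : Elt n → Elt n → Bool
    mrel a b = rel x a b ∨ ((S a ∧ S b) ∨ (S (negE a) ∧ S (negE b)))

    mrel⁻ : ∀ {a b} → T (mrel a b) → Case a b
    mrel⁻ {a} {b} r with ∨⁻ {rel x a b} r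
    ... | inj₁ p = in-x p
    ... | inj₂ r' with ∨⁻ {S a ∧ S b} r'
    ... | inj₁ q = in-S (proj₁ (∧⁻ q)) (proj₂ (∧⁻ q))
    ... | inj₂ q = in-−S (proj₁ (∧⁻ {S (negE a)} q)) (proj₂ (∧⁻ {S (negE a)} q))

    mrel⁺ : ∀ {a b} → Case a b → T (mrel a b)
    mrel⁺ (in-x r) = ∨⁺ˡ r
    mrel⁺ {a} {b} (in-S p q) = ∨⁺ʳ {rel x a b} (∨⁺ˡ (∧⁺ p q))
    mrel⁺ {a} {b} (in-−S p q) = ∨⁺ʳ {rel x a b} (∨⁺ʳ {S a ∧ S b} (∧⁺ p q))

  -- Abstract, and accessed only through case-of / of-case: otherwise goals mentioning a
  -- merged partition get normalised through its proof fields, which is prohibitively slow.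
  abstract
    merged : Part n
    merged = record
      { rel = mrel
      ; reflR = λ a → mrel⁺ (in-x (∼-refl x a))
      ; symR = λ _ _ → mrel⁺ ∘ case-sym ∘ mrel⁻
      ; transR = λ _ _ _ r r' → mrel⁺ (case-trans (mrel⁻ r) (mrel⁻ r'))
      ; negClosed = λ _ _ → mrel⁺ ∘ case-neg ∘ mrel⁻
      ; zeroCond = λ _ → mrel⁺ ∘ case-zero ∘ mrel⁻
      }

    case-of : ∀ {a b} → a ∼[ merged ] b → Case a b
    case-of = mrel⁻

    of-case : ∀ {a b} → Case a b → a ∼[ merged ] b
    of-case = mrel⁺

  x≼merged : x ≼ merged
  x≼merged a b = of-case ∘ in-x

  merged-least : ∀ w → x ≼ w → (∀ {a b} → T (S a) → T (S b) → a ∼[ w ] b) → merged ≼ w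
  merged-least w x≼w joins a b r with case-of r
  ... | in-x r' = x≼w a b r'
  ... | in-S p q = joins p q
  ... | in-−S p q = ∼-neg⁻ w (joins p q)

  Spreads : Set
  Spreads = ∀ w → x ≼ w → ∀ {u v} → T (S u) → T (S v) → ¬ u ∼[ x ] v → u ∼[ w ] v →
            ∀ {a b} → T (S a) → T (S b) → a ∼[ w ] b

  merged-covers : ∀ s {u v} → T (S u) → T (S v) → ¬ u ∼[ x ] v → Spreads → CoverP s x merged
  merged-covers s {u} {v} su sv u≁v spreads =
    (x≼merged , λ m≼x → u≁v (m≼x u v (of-case (in-S su sv)))) , between
    where
    between : ∀ w → InP s w → x ≼ w → w ≼ merged → (w ≈ x) ⊎ (w ≈ merged)
    between w _ x≼w w≼m with ≼-or-separated w x
    ... | inj₁ w≼x = inj₁ (w≼x , x≼w)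
    ... | inj₂ (a , b , a∼b , a≁b) with case-of (w≼m a b a∼b)
    ... | in-x r = ⊥-elim (a≁b r)
    ... | in-S p q = inj₂ (w≼m , merged-least w x≼w (spreads w x≼w p q a≁b a∼b))
    ... | in-−S p q =
      inj₂ (w≼m , merged-least w x≼w (spreads w x≼w p q (a≁b ∘ ∼-neg⁻ x) (∼-neg w a∼b)))

merged-irrelevant : ∀ {n} {x : Part n} {S} {c c' : UnionOfBlocks x S} {s s' : SignShape S} →
                    Merge.merged x S c s ≼ Merge.merged x S c' s'
merged-irrelevant {x = x} {S} {c} {c'} {s} {s'} a b r with Merge.case-of x S c s r
... | Merge.in-x p = Merge.of-case x S c' s' (Merge.in-x p)
... | Merge.in-S p q = Merge.of-case x S c' s' (Merge.in-S p q)
... | Merge.in-−S p q = Merge.of-case x S c' s' (Merge.in-−S p q)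

module PairMerge {n} (x : Part n) (a b : Elt n)
  (a≁-a : ¬ a ∼[ x ] negE a) (b≁-b : ¬ b ∼[ x ] negE b) (a≁-b : ¬ a ∼[ x ] negE b) where

  S : Elt n → Bool
  S u = rel x a u ∨ rel x b u

  data InS (u : Elt n) : Set where
    near-a : a ∼[ x ] u → InS u
    near-b : b ∼[ x ] u → InS u

  inS : ∀ {u} → T (S u) → InS u
  inS {u} s = [ near-a , near-b ] (∨⁻ {rel x a u} s)

  S-closed : UnionOfBlocks x S
  S-closed {b = v} r s with inS s
  ... | near-a p = ∨⁺ˡ (∼-trans x p r)
  ... | near-b p = ∨⁺ʳ {rel x a v} (∼-trans x p r)

  S-disjoint : ∀ e → T (S e) → ¬ T (S (negE e))
  S-disjoint e s s' with inS s | inS s'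
  ... | near-a p | near-a q = a≁-a (∼-trans x q (∼-sym x (∼-neg x p)))
  ... | near-a p | near-b q = a≁-b (∼-negˡ x (∼-sym x (∼-trans x q (∼-sym x (∼-neg x p)))))
  ... | near-b p | near-a q = a≁-b (∼-trans x q (∼-sym x (∼-neg x p)))
  ... | near-b p | near-b q = b≁-b (∼-trans x q (∼-sym x (∼-neg x p)))

  open Merge x S S-closed (inj₁ S-disjoint) public

  a∈S : T (S a)
  a∈S = ∨⁺ˡ (∼-refl x a)

  b∈S : T (S b)
  b∈S = ∨⁺ʳ {rel x a b} (∼-refl x b)

  a∼b : a ∼[ merged ] b
  a∼b = of-case (in-S a∈S b∈S)

  merged-least-pair : ∀ w → x ≼ w → a ∼[ w ] b → merged ≼ w
  merged-least-pair w x≼w a∼ʷb = merged-least w x≼w λ p q → ∼-trans w (∼-sym w (to-a p)) (to-a q)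
    where
    to-a : ∀ {c} → T (S c) → a ∼[ w ] c
    to-a s with inS s
    ... | near-a p = x≼w _ _ p
    ... | near-b p = ∼-trans w a∼ʷb (x≼w _ _ p)

  covers : ∀ s → ¬ a ∼[ x ] b → CoverP s x merged
  covers s a≁b = merged-covers s a∈S b∈S a≁b spreads
    where
    spreads : Spreads
    spreads w x≼w su sv u≁v u∼v p q = merged-least-pair w x≼w a∼ʷb _ _ (of-case (in-S p q))
      where
      a∼ʷb : a ∼[ w ] b
      a∼ʷb with inS su | inS sv
      ... | near-a p | near-a q = ⊥-elim (u≁v (∼-trans x (∼-sym x p) q))
      ... | near-a p | near-b q = ∼-trans w (x≼w _ _ p) (∼-trans w u∼v (x≼w _ _ (∼-sym x q)))
      ... | near-b p | near-a q = ∼-sym w (∼-trans w (x≼w _ _ p) (∼-trans w u∼v (x≼w _ _ (∼-sym x q))))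
      ... | near-b p | near-b q = ⊥-elim (u≁v (∼-trans x (∼-sym x p) q))

  zeroBlock-unchanged : ¬ T (S zer) → ∀ f → zer ∼[ merged ] f → zer ∼[ x ] f
  zeroBlock-unchanged zer∉S f r with case-of r
  ... | in-x p = p
  ... | in-S p _ = ⊥-elim (zer∉S p)
  ... | in-−S p _ = ⊥-elim (zer∉S p)

module Absorb {n} (x : Part n) (e : Elt n) where

  S : Elt n → Bool
  S u = rel x zer u ∨ (rel x e u ∨ rel x (negE e) u)

  data InS (u : Elt n) : Set where
    near-0 : zer ∼[ x ] u → InS u
    near-e : e ∼[ x ] u → InS u
    near-−e : negE e ∼[ x ] u → InS u

  inS : ∀ {u} → T (S u) → InS u
  inS {u} s with ∨⁻ {rel x zer u} s
  ... | inj₁ p = near-0 p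
  ... | inj₂ s' = [ near-e , near-−e ] (∨⁻ {rel x e u} s')

  S⁺ : ∀ {u} → InS u → T (S u)
  S⁺ (near-0 p) = ∨⁺ˡ p
  S⁺ {u} (near-e p) = ∨⁺ʳ {rel x zer u} (∨⁺ˡ p)
  S⁺ {u} (near-−e p) = ∨⁺ʳ {rel x zer u} (∨⁺ʳ {rel x e u} p)

  S-closed : UnionOfBlocks x S
  S-closed r s with inS s
  ... | near-0 p = S⁺ (near-0 (∼-trans x p r))
  ... | near-e p = S⁺ (near-e (∼-trans x p r))
  ... | near-−e p = S⁺ (near-−e (∼-trans x p r))

  S-neg : ∀ u → T (S u) → T (S (negE u))
  S-neg u s with inS s
  ... | near-0 p = S⁺ (near-0 (∼-neg x p))
  ... | near-e p = S⁺ (near-−e (∼-neg x p))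
  ... | near-−e p = S⁺ (near-e (subst (λ g → g ∼[ x ] negE u) (negE-involutive e) (∼-neg x p)))

  open Merge x S S-closed (inj₂ (S⁺ (near-0 (∼-refl x zer)) , S-neg)) public

  zer∼e : zer ∼[ merged ] e
  zer∼e = of-case (in-S (S⁺ (near-0 (∼-refl x zer))) (S⁺ (near-e (∼-refl x e))))

  merged-least-absorb : ∀ w → x ≼ w → zer ∼[ w ] e → merged ≼ w
  merged-least-absorb w x≼w zer∼ʷe = merged-least w x≼w λ p q → ∼-trans w (∼-sym w (to-zer p)) (to-zer q)
    where
    to-zer : ∀ {c} → T (S c) → zer ∼[ w ] c
    to-zer s with inS s
    ... | near-0 p = x≼w _ _ p
    ... | near-e p = ∼-trans w zer∼ʷe (x≼w _ _ p)
    ... | near-−e p = ∼-trans w (∼-neg w zer∼ʷe) (x≼w _ _ p)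

  covers : ∀ s → ¬ zer ∼[ x ] e → CoverP s x merged
  covers s zer≁e = merged-covers s (S⁺ (near-0 (∼-refl x zer))) (S⁺ (near-e (∼-refl x e))) zer≁e spreads
    where
    spreads : Spreads
    spreads w x≼w {u} {v} su sv u≁v u∼v p q = merged-least-absorb w x≼w zer∼ʷe _ _ (of-case (in-S p q))
      where
      joined : ∀ {c d} → c ∼[ x ] u → d ∼[ x ] v → c ∼[ w ] d
      joined p q = ∼-trans w (x≼w _ _ p) (∼-trans w u∼v (x≼w _ _ (∼-sym x q)))
      zer∼ʷe : zer ∼[ w ] e
      zer∼ʷe with inS su | inS sv
      ... | near-0 p | near-0 q = ⊥-elim (u≁v (∼-trans x (∼-sym x p) q))
      ... | near-e p | near-e q = ⊥-elim (u≁v (∼-trans x (∼-sym x p) q))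
      ... | near-−e p | near-−e q = ⊥-elim (u≁v (∼-trans x (∼-sym x p) q))
      ... | near-0 p | near-e q = joined p q
      ... | near-e p | near-0 q = ∼-sym w (joined p q)
      ... | near-0 p | near-−e q = zero-∼-neg⁻ w (joined p q)
      ... | near-−e p | near-0 q = zero-∼-neg⁻ w (∼-sym w (joined p q))
      ... | near-e p | near-−e q = self-neg⇒zero w e (joined p q)
      ... | near-−e p | near-e q = self-neg⇒zero w e (∼-sym w (joined p q))

IsBlock-zero-transfer : ∀ {n} {w v : Part n} {B : Elt n → Set} → (∀ f → zer ∼[ w ] f → zer ∼[ v ] f) →
                        (∀ f → zer ∼[ v ] f → zer ∼[ w ] f) → B zer → IsBlock w B → IsBlock v B
IsBlock-zero-transfer {w = w} w⊆v v⊆w zer∈B (a , block) =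
  zer , λ e → (λ r → proj₁ (block e) (∼-trans w a∼zer (v⊆w e r))) ,
              (λ e∈B → w⊆v e (∼-trans w (∼-sym w a∼zer) (proj₂ (block e) e∈B)))
  where
  a∼zer : a ∼[ w ] zer
  a∼zer = proj₂ (block zer) zer∈B

InP-zeroBlock : ∀ {n} s {w v : Part n} → (∀ f → zer ∼[ w ] f → zer ∼[ v ] f) →
                (∀ f → zer ∼[ v ] f → zer ∼[ w ] f) → InP s v → InP s w
InP-zeroBlock s {w} {v} w⊆v v⊆w v∈P i s≤i =
  v∈P i s≤i ∘ IsBlock-zero-transfer {w = w} {v} w⊆v v⊆w (inj₂ (inj₁ refl))

-- Normalized representatives

NormRep : ∀ {n} → Part n → Fin n → Set
NormRep x i = T (isNormRepᵇ x i)

module _ {n} (x : Part n) where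

  normRep-nonzero : ∀ {i} → NormRep x i → ¬ zer ∼[ x ] pos i
  normRep-nonzero t = not⁻ (proj₁ (∧⁻ t))

  normRep-least : ∀ {i k} → NormRep x i → toℕ k < toℕ i → ¬ pos k ∼[ x ] pos i × ¬ neg k ∼[ x ] pos i
  normRep-least {i} {k} t k<i
    with ∨⁻ (lookup (all⁺ _ (allFin n) (proj₂ (∧⁻ {not (rel x zer (pos i))} t))) (∈-allFin k))
  ... | inj₁ k≮i = ⊥-elim (not⁻ k≮i (<⇒<ᵇ k<i))
  ... | inj₂ p = not⁻ (proj₁ (∧⁻ p)) , not⁻ (proj₂ (∧⁻ {not (rel x (pos k) (pos i))} p))

  normRep-intro : ∀ {i} → ¬ zer ∼[ x ] pos i →
                  (∀ k → toℕ k < toℕ i → ¬ pos k ∼[ x ] pos i × ¬ neg k ∼[ x ] pos i) → NormRep x i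
  normRep-intro {i} i≁0 least = ∧⁺ (not⁺ i≁0) (all⁻ _ (tabulate below))
    where
    below : ∀ {k} → k ∈ allFin n →
            T (not (toℕ k <ᵇ toℕ i) ∨ (not (rel x (pos k) (pos i)) ∧ not (rel x (neg k) (pos i))))
    below {k} _ with toℕ k <? toℕ i
    ... | yes k<i =
      ∨⁺ʳ {not (toℕ k <ᵇ toℕ i)} (∧⁺ (not⁺ (proj₁ (least k k<i))) (not⁺ (proj₂ (least k k<i))))
    ... | no k≮i = ∨⁺ˡ (not⁺ (k≮i ∘ <ᵇ⇒< _ _))

  normRep-apart : ∀ {i j} → NormRep x i → NormRep x j → i ≢ j →
                  ¬ pos i ∼[ x ] pos j × ¬ pos i ∼[ x ] neg j
  normRep-apart {i} {j} ti tj i≢j with <-cmp i j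
  ... | tri< i<j _ _ = proj₁ (normRep-least tj i<j) , proj₂ (normRep-least tj i<j) ∘ ∼-neg x
  ... | tri≈ _ i≡j _ = ⊥-elim (i≢j i≡j)
  ... | tri> _ _ j<i = proj₁ (normRep-least ti j<i) ∘ ∼-sym x , proj₂ (normRep-least ti j<i) ∘ ∼-sym x

  normRep-unique : ∀ {i j} → NormRep x i → NormRep x j → pos i ∼[ x ] pos j → i ≡ j
  normRep-unique {i} {j} ti tj r with i ≟ j
  ... | yes i≡j = i≡j
  ... | no i≢j = ⊥-elim (proj₁ (normRep-apart ti tj i≢j) r)

  normRep-not-opposite : ∀ {i j} → NormRep x i → NormRep x j → ¬ pos i ∼[ x ] neg j
  normRep-not-opposite {i} {j} ti tj r with i ≟ j
  ... | yes refl = normRep-nonzero ti (zeroCond x i r)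
  ... | no i≢j = proj₂ (normRep-apart ti tj i≢j) r

  RepresentedBy : Elt n → Fin n → Set
  RepresentedBy u i = u ∼[ x ] pos i ⊎ u ∼[ x ] neg i

  representative : ∀ u → ¬ zer ∼[ x ] u → ∃ λ i → NormRep x i × RepresentedBy u i
  representative u u≁0 with leastFin (RepresentedBy u) represents? (start u u≁0)
    where
    represents? : ∀ i → Dec (RepresentedBy u i)
    represents? i with T? (rel x u (pos i)) | T? (rel x u (neg i))
    ... | yes p | _ = yes (inj₁ p)
    ... | no _ | yes q = yes (inj₂ q)
    ... | no p | no q = no [ p , q ]
    start : ∀ u → ¬ zer ∼[ x ] u → ∃ (RepresentedBy u)
    start zer u≁0 = ⊥-elim (u≁0 (∼-refl x zer))
    start (pos k) _ = k , inj₁ (∼-refl x (pos k))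
    start (neg k) _ = k , inj₂ (∼-refl x (neg k))
  ... | i , u~i , least = i , normRep-intro i≁0 (λ k k<i → not-pos k k<i u~i , not-neg k k<i u~i) , u~i
    where
    i≁0 : ¬ zer ∼[ x ] pos i
    i≁0 r = [ (λ p → u≁0 (∼-trans x r (∼-sym x p))) ,
              (λ p → u≁0 (∼-trans x (∼-neg x r) (∼-sym x p))) ] u~i
    not-pos : ∀ k → toℕ k < toℕ i → RepresentedBy u i → ¬ pos k ∼[ x ] pos i
    not-pos k k<i (inj₁ p) r = least k k<i (inj₁ (∼-trans x p (∼-sym x r)))
    not-pos k k<i (inj₂ p) r = least k k<i (inj₂ (∼-trans x p (∼-sym x (∼-neg x r))))
    not-neg : ∀ k → toℕ k < toℕ i → RepresentedBy u i → ¬ neg k ∼[ x ] pos i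
    not-neg k k<i (inj₁ p) r = least k k<i (inj₂ (∼-trans x p (∼-sym x r)))
    not-neg k k<i (inj₂ p) r = least k k<i (inj₁ (∼-trans x p (∼-sym x (∼-neg x r))))

normRep-anti : ∀ {n} {x z : Part n} {i} → x ≼ z → NormRep z i → NormRep x i
normRep-anti {x = x} {z} x≼z t =
  normRep-intro x (normRep-nonzero z t ∘ x≼z _ _)
    (λ k k<i → proj₁ (normRep-least z t k<i) ∘ x≼z _ _ , proj₂ (normRep-least z t k<i) ∘ x≼z _ _)

module _ {n} {x z : Part n} where

  signed⁺ : ∀ e → zer ∼[ z ] e → ¬ zer ∼[ x ] e → T (signedᵇ x z)
  signed⁺ e p q = any⁺ _ (lose (∈-allElt e) (∧⁺ p (not⁺ q)))

  signed⁻ : T (signedᵇ x z) → ∃ λ e → zer ∼[ z ] e × ¬ zer ∼[ x ] e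
  signed⁻ t with satisfied (any⁻ _ (allElt n) t)
  ... | e , u = e , proj₁ (∧⁻ u) , not⁻ (proj₂ (∧⁻ {rel z zer e} u))

  unsigned-zeroBlock : ¬ T (signedᵇ x z) → ∀ e → zer ∼[ z ] e → zer ∼[ x ] e
  unsigned-zeroBlock unsigned e r with T? (rel x zer e)
  ... | yes p = p
  ... | no ¬p = ⊥-elim (unsigned (signed⁺ e r ¬p))

  lam-signed : T (signedᵇ x z) → lam x z ≡ (1 , 1)
  lam-signed t with signedᵇ x z
  ... | true = refl

  lam-unsigned : ¬ T (signedᵇ x z) → lam x z ≡ unsignedLabel x z (cartesianProduct (allFin n) (allFin n))
  lam-unsigned ¬t with signedᵇ x z
  ... | true = ⊥-elim (¬t tt)
  ... | false = refl

pairLabel : ∀ {n} → Part n → Fin n × Fin n → Label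
pairLabel z (i , j) = if rel z (pos i) (pos j) then (0 , suc (toℕ i ⊔ toℕ j)) else (2 , suc (toℕ i ⊓ toℕ j))

Candidate : ∀ {n} → Part n → Part n → Fin n × Fin n → Set
Candidate x z (i , j) = T (candᵇ x z i j)

module _ {n} {x z : Part n} where

  candidate⁺ : ∀ {i j} → NormRep x i → NormRep x j → i ≢ j →
               pos i ∼[ z ] pos j ⊎ pos i ∼[ z ] neg j → Candidate x z (i , j)
  candidate⁺ {i} {j} ti tj i≢j joined =
    ∧⁺ ti (∧⁺ tj (∧⁺ (not⁺ (proj₁ apart)) (∧⁺ (not⁺ (proj₂ apart))
      ([ ∨⁺ˡ , ∨⁺ʳ {rel z (pos i) (pos j)} ] joined))))
    where
    apart : ¬ pos i ∼[ x ] pos j × ¬ pos i ∼[ x ] neg j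
    apart = normRep-apart x ti tj i≢j

  candidate⁻ : ∀ {i j} → Candidate x z (i , j) →
               NormRep x i × NormRep x j × i ≢ j × (pos i ∼[ z ] pos j ⊎ pos i ∼[ z ] neg j)
  candidate⁻ {i} {j} c =
    let ti , c₁ = ∧⁻ c
        tj , c₂ = ∧⁻ {isNormRepᵇ x j} c₁
        i≁j , c₃ = ∧⁻ {not (rel x (pos i) (pos j))} c₂
        _ , joined = ∧⁻ {not (rel x (pos i) (neg j))} c₃
    in ti , tj , (λ { refl → not⁻ i≁j (∼-refl x (pos i)) }) , ∨⁻ joined

  unsignedLabel-found : ∀ l → (∃ λ p → p ∈ l × Candidate x z p) →
                        ∃ λ q → Candidate x z q × unsignedLabel x z l ≡ pairLabel z q
  unsignedLabel-found ((i , j) ∷ ps) found with candᵇ x z i j in eq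
  ... | true = (i , j) , subst T (sym eq) tt , refl
  ... | false with found
  ... | q , here refl , c = ⊥-elim (subst T eq c)
  ... | q , there q∈ps , c = unsignedLabel-found ps (q , q∈ps , c)

  separated-nonzero : x ≼ z → ¬ T (signedᵇ x z) →
                      ∀ {u v} → u ∼[ z ] v → ¬ u ∼[ x ] v → ¬ zer ∼[ x ] u
  separated-nonzero x≼z unsigned {u} {v} u∼v u≁v r =
    u≁v (∼-trans x (∼-sym x r) (unsigned-zeroBlock {x = x} {z} unsigned v (∼-trans z (x≼z _ _ r) u∼v)))

  separated-candidate : x ≼ z → ¬ T (signedᵇ x z) →
                        ∀ {u v} → u ∼[ z ] v → ¬ u ∼[ x ] v → ∃ (Candidate x z)
  separated-candidate x≼z unsigned {u} {v} u∼v u≁v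
    with representative x u (separated-nonzero x≼z unsigned u∼v u≁v)
       | representative x v (separated-nonzero x≼z unsigned (∼-sym z u∼v) (u≁v ∘ ∼-sym x))
  ... | a , ta , u~a | b , tb , v~b = (a , b) , candidate⁺ ta tb a≢b (joined u~a v~b)
    where
    through : ∀ {c d} → u ∼[ x ] c → v ∼[ x ] d → c ∼[ z ] d
    through p q = ∼-trans z (∼-sym z (x≼z _ _ p)) (∼-trans z u∼v (x≼z _ _ q))
    joined : RepresentedBy x u a → RepresentedBy x v b → pos a ∼[ z ] pos b ⊎ pos a ∼[ z ] neg b
    joined (inj₁ p) (inj₁ q) = inj₁ (through p q)
    joined (inj₁ p) (inj₂ q) = inj₂ (through p q)
    joined (inj₂ p) (inj₁ q) = inj₂ (∼-neg z (through p q))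
    joined (inj₂ p) (inj₂ q) = inj₁ (∼-neg z (through p q))
    zero-kept : ∀ {i} → pos i ∼[ z ] neg i → zer ∼[ x ] pos i
    zero-kept {i} r = unsigned-zeroBlock {x = x} {z} unsigned (pos i) (zeroCond z i r)
    same-rep : ∀ {i} → NormRep x i → RepresentedBy x u i → RepresentedBy x v i → ⊥
    same-rep t (inj₁ p) (inj₁ q) = u≁v (∼-trans x p (∼-sym x q))
    same-rep t (inj₂ p) (inj₂ q) = u≁v (∼-trans x p (∼-sym x q))
    same-rep t (inj₁ p) (inj₂ q) = normRep-nonzero x t (zero-kept (through p q))
    same-rep t (inj₂ p) (inj₁ q) = normRep-nonzero x t (zero-kept (∼-sym z (through p q)))
    a≢b : a ≢ b
    a≢b a≡b = same-rep ta u~a (subst (RepresentedBy x v) (sym a≡b) v~b)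

  unsigned-candidate : x ≼ z → ¬ z ≼ x → ¬ T (signedᵇ x z) → ∃ (Candidate x z)
  unsigned-candidate x≼z z⋠x unsigned with ≼-or-separated z x
  ... | inj₁ z≼x = ⊥-elim (z⋠x z≼x)
  ... | inj₂ (u , v , u∼v , u≁v) = separated-candidate x≼z unsigned u∼v u≁v

module _ {n} (z : Part n) (i j : Fin n) where

  pairLabel-coherent : pos i ∼[ z ] pos j → pairLabel z (i , j) ≡ (0 , suc (toℕ i ⊔ toℕ j))
  pairLabel-coherent r with rel z (pos i) (pos j)
  ... | true = refl

  pairLabel-noncoherent : ¬ pos i ∼[ z ] pos j → pairLabel z (i , j) ≡ (2 , suc (toℕ i ⊓ toℕ j))
  pairLabel-noncoherent ¬r with rel z (pos i) (pos j)
  ... | true = ⊥-elim (¬r tt)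
  ... | false = refl

data UnsignedStep {n} (x z : Part n) : Set where
  coherent : ∀ a b → NormRep x a → NormRep x b → a ≢ b → pos a ∼[ z ] pos b →
             lam x z ≡ (0 , suc (toℕ a ⊔ toℕ b)) → UnsignedStep x z
  noncoherent : ∀ a b → NormRep x a → NormRep x b → a ≢ b → ¬ pos a ∼[ z ] pos b → pos a ∼[ z ] neg b →
                lam x z ≡ (2 , suc (toℕ a ⊓ toℕ b)) → UnsignedStep x z

unsignedStep : ∀ {n} {x z : Part n} → x ≼ z → ¬ z ≼ x → ¬ T (signedᵇ x z) → UnsignedStep x z
unsignedStep {n} {x} {z} x≼z z⋠x unsigned
  with unsigned-candidate {x = x} {z} x≼z z⋠x unsigned
... | (a₀ , b₀) , c₀
  with unsignedLabel-found {x = x} {z} (cartesianProduct (allFin n) (allFin n))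
         ((a₀ , b₀) , ∈-cartesianProduct⁺ (∈-allFin a₀) (∈-allFin b₀) , c₀)
... | (a , b) , c , eq with candidate⁻ {x = x} {z} c
... | ta , tb , a≢b , joined with T? (rel z (pos a) (pos b))
... | yes a∼b = coherent a b ta tb a≢b a∼b
                  (trans (lam-unsigned {x = x} {z} unsigned) (trans eq (pairLabel-coherent z a b a∼b)))
... | no a≁b = noncoherent a b ta tb a≢b a≁b ([ ⊥-elim ∘ a≁b , (λ a∼-b → a∼-b) ] joined)
                  (trans (lam-unsigned {x = x} {z} unsigned) (trans eq (pairLabel-noncoherent z a b a≁b)))

cover-≈ : ∀ {n s} {x z m : Part n} → CoverP s x z → InP s m → x ≼ m → ¬ m ≼ x → m ≼ z → z ≈ m
cover-≈ {z = z} {m} (_ , between) m∈P x≼m m⋠x m≼z with between m m∈P x≼m m≼z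
... | inj₁ (m≼x , _) = ⊥-elim (m⋠x m≼x)
... | inj₂ m≈z = ≈-sym {x = m} {z} m≈z

data Sign : Set where
  plus minus : Sign

elt : ∀ {n} → Sign → Fin n → Elt n
elt plus i = pos i
elt minus i = neg i

flip : Sign → Sign
flip plus = minus
flip minus = plus

negE-elt : ∀ {n} σ (i : Fin n) → negE (elt σ i) ≡ elt (flip σ) i
negE-elt plus i = refl
negE-elt minus i = refl

module _ {n} (x : Part n) where

  normRep-signed : ∀ {a b σ τ} → NormRep x a → NormRep x b → elt σ a ∼[ x ] elt τ b → a ≡ b × σ ≡ τ
  normRep-signed {σ = plus} {plus} ta tb r = normRep-unique x ta tb r , refl
  normRep-signed {σ = plus} {minus} ta tb r = ⊥-elim (normRep-not-opposite x ta tb r)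
  normRep-signed {σ = minus} {plus} ta tb r = ⊥-elim (normRep-not-opposite x tb ta (∼-sym x r))
  normRep-signed {σ = minus} {minus} ta tb r = normRep-unique x ta tb (∼-neg x r) , refl

  normRep-not-self-neg : ∀ {a} σ → NormRep x a → ¬ elt σ a ∼[ x ] negE (elt σ a)
  normRep-not-self-neg {a} σ ta r
    with normRep-signed {σ = σ} ta ta (subst (λ e → elt σ a ∼[ x ] e) (negE-elt σ a) r)
  normRep-not-self-neg plus ta r | _ , ()
  normRep-not-self-neg minus ta r | _ , ()

  normRep-nonzero± : ∀ {a} σ → NormRep x a → ¬ zer ∼[ x ] elt σ a
  normRep-nonzero± plus ta = normRep-nonzero x ta
  normRep-nonzero± minus ta = normRep-nonzero x ta ∘ zero-∼-neg⁻ x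

  normRep-least± : ∀ {a k} σ τ → NormRep x a → toℕ k < toℕ a → ¬ elt τ k ∼[ x ] elt σ a
  normRep-least± plus plus ta k<a = proj₁ (normRep-least x ta k<a)
  normRep-least± plus minus ta k<a = proj₂ (normRep-least x ta k<a)
  normRep-least± minus plus ta k<a = proj₂ (normRep-least x ta k<a) ∘ ∼-neg x
  normRep-least± minus minus ta k<a = proj₁ (normRep-least x ta k<a) ∘ ∼-neg x

module MergeNormReps {n} (x : Part n) (σ : Sign) {i j : Fin n}
  (ti : NormRep x i) (tj : NormRep x j) (i<j : toℕ i < toℕ j) where

  i≢j : i ≢ j
  i≢j = <⇒≢ i<j

  private
    i≁±j : ∀ τ → ¬ pos i ∼[ x ] elt τ j
    i≁±j τ = i≢j ∘ proj₁ ∘ normRep-signed x {σ = plus} ti tj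

  open PairMerge x (pos i) (elt σ j) (normRep-not-self-neg x plus ti) (normRep-not-self-neg x σ tj)
    (i≁±j (flip σ) ∘ subst (λ e → pos i ∼[ x ] e) (negE-elt σ j)) public

  S-rep : ∀ {a τ} → NormRep x a → T (S (elt τ a)) → (a ≡ i × τ ≡ plus) ⊎ (a ≡ j × τ ≡ σ)
  S-rep ta s with inS s
  ... | near-a p = let i≡a , plus≡τ = normRep-signed x ti ta p in inj₁ (sym i≡a , sym plus≡τ)
  ... | near-b p = let j≡a , σ≡τ = normRep-signed x tj ta p in inj₂ (sym j≡a , sym σ≡τ)

  zer∉S : ¬ T (S zer)
  zer∉S s with inS s
  ... | near-a p = normRep-nonzero x ti (∼-sym x p)
  ... | near-b p = normRep-nonzero± x σ tj (∼-sym x p)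

  zeroBlock-kept : ∀ f → zer ∼[ merged ] f → zer ∼[ x ] f
  zeroBlock-kept = zeroBlock-unchanged zer∉S

  merged-InP : ∀ s → InP s x → InP s merged
  merged-InP s = InP-zeroBlock s {merged} {x} zeroBlock-kept (λ f → x≼merged zer f)

  is-cover : ∀ s → CoverP s x merged
  is-cover s = covers s (i≁±j σ)

  merged⋠x : ¬ merged ≼ x
  merged⋠x m≼x = i≁±j σ (m≼x _ _ a∼b)

  unsigned : ¬ T (signedᵇ x merged)
  unsigned t = let e , p , q = signed⁻ {x = x} {merged} t in q (zeroBlock-kept e p)

  normRep-kept : ∀ {k} → NormRep x k → k ≢ j → NormRep merged k
  normRep-kept {k} tk k≢j =
    normRep-intro merged (normRep-nonzero x tk ∘ zeroBlock-kept _) (λ k' k'<k → below plus k'<k , below minus k'<k)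
    where
    below : ∀ {k'} τ → toℕ k' < toℕ k → ¬ elt τ k' ∼[ merged ] pos k
    below τ k'<k r with case-of r
    ... | in-x p = normRep-least± x plus τ tk k'<k p
    ... | in-−S _ q = [ (λ { (_ , ()) }) , (λ (k≡j , _) → k≢j k≡j) ] (S-rep {τ = minus} tk q)
    ... | in-S p q with S-rep {τ = plus} tk q
    ...   | inj₂ (k≡j , _) = k≢j k≡j
    ...   | inj₁ (refl , _) with inS p
    ...     | near-a p' = normRep-least± x plus τ ti k'<k (∼-sym x p')
    ...     | near-b p' = normRep-least± x σ τ tj (<-trans k'<k i<j) (∼-sym x p')

  normRep-kept-below : ∀ {w k} → w ≼ merged → NormRep x k → k ≢ j → NormRep w k
  normRep-kept-below {w} w≼m tk k≢j = normRep-anti {x = w} {merged} w≼m (normRep-kept tk k≢j)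

module CoherentMerge {n} (x : Part n) {i j : Fin n}
  (ti : NormRep x i) (tj : NormRep x j) (i<j : toℕ i < toℕ j) where

  open MergeNormReps x plus ti tj i<j public

  private
    pos-in-S : ∀ {a} → NormRep x a → T (S (pos a)) → a ≡ i ⊎ a ≡ j
    pos-in-S ta s = [ inj₁ ∘ proj₁ , inj₂ ∘ proj₁ ] (S-rep {τ = plus} ta s)

    neg∉S : ∀ {a} → NormRep x a → ¬ T (S (neg a))
    neg∉S ta s = [ (λ { (_ , ()) }) , (λ { (_ , ()) }) ] (S-rep {τ = minus} ta s)

    joined-reps : ∀ {a b} → NormRep x a → NormRep x b → a ≢ b → pos a ∼[ merged ] pos b →
                  toℕ a ⊔ toℕ b ≡ toℕ j
    joined-reps ta tb a≢b r with case-of r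
    ... | in-x p = ⊥-elim (proj₁ (normRep-apart x ta tb a≢b) p)
    ... | in-−S p _ = ⊥-elim (neg∉S ta p)
    ... | in-S p q with pos-in-S ta p | pos-in-S tb q
    ...   | inj₁ refl | inj₁ refl = ⊥-elim (a≢b refl)
    ...   | inj₂ refl | inj₂ refl = ⊥-elim (a≢b refl)
    ...   | inj₁ refl | inj₂ refl = m≤n⇒m⊔n≡n (<⇒≤ i<j)
    ...   | inj₂ refl | inj₁ refl = m≥n⇒m⊔n≡m (<⇒≤ i<j)

    no-opposite : ∀ {a b} → NormRep x a → NormRep x b → ¬ pos a ∼[ merged ] neg b
    no-opposite ta tb r with case-of r
    ... | in-x p = normRep-not-opposite x ta tb p
    ... | in-S _ q = neg∉S tb q
    ... | in-−S p _ = neg∉S ta p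

    label-of : UnsignedStep x merged → lam x merged ≡ (0 , suc (toℕ j))
    label-of (coherent a b ta tb a≢b r eq) = trans eq (cong (λ m → 0 , suc m) (joined-reps ta tb a≢b r))
    label-of (noncoherent a b ta tb _ _ r _) = ⊥-elim (no-opposite ta tb r)

  label : lam x merged ≡ (0 , suc (toℕ j))
  label = label-of (unsignedStep {x = x} {merged} x≼merged merged⋠x unsigned)

module NonCoherentMerge {n} (x : Part n) {i j : Fin n}
  (ti : NormRep x i) (tj : NormRep x j) (i<j : toℕ i < toℕ j) where

  open MergeNormReps x minus ti tj i<j public

  private
    pos-in-S : ∀ {a} → NormRep x a → T (S (pos a)) → a ≡ i
    pos-in-S ta s = [ proj₁ , (λ { (_ , ()) }) ] (S-rep {τ = plus} ta s)

    neg-in-S : ∀ {a} → NormRep x a → T (S (neg a)) → a ≡ j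
    neg-in-S ta s = [ (λ { (_ , ()) }) , proj₁ ] (S-rep {τ = minus} ta s)

    no-coherent : ∀ {a b} → NormRep x a → NormRep x b → a ≢ b → ¬ pos a ∼[ merged ] pos b
    no-coherent ta tb a≢b r with case-of r
    ... | in-x p = proj₁ (normRep-apart x ta tb a≢b) p
    ... | in-S p q = a≢b (trans (pos-in-S ta p) (sym (pos-in-S tb q)))
    ... | in-−S p q = a≢b (trans (neg-in-S ta p) (sym (neg-in-S tb q)))

    opposite-reps : ∀ {a b} → NormRep x a → NormRep x b → pos a ∼[ merged ] neg b →
                    toℕ a ⊓ toℕ b ≡ toℕ i
    opposite-reps ta tb r with case-of r
    ... | in-x p = ⊥-elim (normRep-not-opposite x ta tb p)
    ... | in-S p q with pos-in-S ta p | neg-in-S tb q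
    ...   | refl | refl = m≤n⇒m⊓n≡m (<⇒≤ i<j)
    opposite-reps ta tb r | in-−S p q with neg-in-S ta p | pos-in-S tb q
    ...   | refl | refl = m≥n⇒m⊓n≡n (<⇒≤ i<j)

    label-of : UnsignedStep x merged → lam x merged ≡ (2 , suc (toℕ i))
    label-of (coherent a b ta tb a≢b r _) = ⊥-elim (no-coherent ta tb a≢b r)
    label-of (noncoherent a b ta tb _ _ r eq) = trans eq (cong (λ m → 2 , suc m) (opposite-reps ta tb r))

  label : lam x merged ≡ (2 , suc (toℕ i))
  label = label-of (unsignedStep {x = x} {merged} x≼merged merged⋠x unsigned)

coherentMerge-≈ : ∀ {n} {x : Part n} {i j} (ti ti' : NormRep x i) (tj tj' : NormRep x j)
                  (i<j i<j' : toℕ i < toℕ j) →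
                  CoherentMerge.merged x ti tj i<j ≈ CoherentMerge.merged x ti' tj' i<j'
coherentMerge-≈ _ _ _ _ _ _ = merged-irrelevant , merged-irrelevant

nonCoherentMerge-≈ : ∀ {n} {x : Part n} {i j} (ti ti' : NormRep x i) (tj tj' : NormRep x j)
                     (i<j i<j' : toℕ i < toℕ j) →
                     NonCoherentMerge.merged x ti tj i<j ≈ NonCoherentMerge.merged x ti' tj' i<j'
nonCoherentMerge-≈ _ _ _ _ _ _ = merged-irrelevant , merged-irrelevant

module _ {n} {x x' z z' : Part n} (x≈x' : x ≈ x') (z≈z' : z ≈ z') where

  private
    rel-x : ∀ a b → rel x a b ≡ rel x' a b
    rel-x a b = T-injective (proj₁ x≈x' a b) (proj₂ x≈x' a b)

    rel-z : ∀ a b → rel z a b ≡ rel z' a b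
    rel-z a b = T-injective (proj₁ z≈z' a b) (proj₂ z≈z' a b)

    normRep-cong : ∀ i → isNormRepᵇ x i ≡ isNormRepᵇ x' i
    normRep-cong i = cong₂ _∧_ (cong not (rel-x _ _)) (cong and (map-cong (λ k →
      cong (not (toℕ k <ᵇ toℕ i) ∨_) (cong₂ _∧_ (cong not (rel-x _ _)) (cong not (rel-x _ _)))) (allFin n)))

    candidate-cong : ∀ i j → candᵇ x z i j ≡ candᵇ x' z' i j
    candidate-cong i j = cong₂ _∧_ (normRep-cong i) (cong₂ _∧_ (normRep-cong j)
      (cong₂ _∧_ (cong not (rel-x _ _)) (cong₂ _∧_ (cong not (rel-x _ _)) (cong₂ _∨_ (rel-z _ _) (rel-z _ _)))))

    unsignedLabel-cong : ∀ l → unsignedLabel x z l ≡ unsignedLabel x' z' l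
    unsignedLabel-cong [] = refl
    unsignedLabel-cong ((i , j) ∷ l) = if-cong (candidate-cong i j) (if-cong (rel-z _ _) refl refl) (unsignedLabel-cong l)

  lam-cong : lam x z ≡ lam x' z'
  lam-cong = if-cong (cong or (map-cong (λ e → cong₂ _∧_ (rel-z zer e) (cong not (rel-x zer e))) (allElt n)))
                     refl (unsignedLabel-cong (cartesianProduct (allFin n) (allFin n)))

<L-trans : ∀ {a b c} → a <L b → b <L c → a <L c
<L-trans (inj₁ p) (inj₁ q) = inj₁ (<-trans p q)
<L-trans (inj₁ p) (inj₂ (refl , _)) = inj₁ p
<L-trans (inj₂ (refl , _)) (inj₁ q) = inj₁ q
<L-trans (inj₂ (refl , p)) (inj₂ (refl , q)) = inj₂ (refl , <-trans p q)

<L-irrefl : ∀ {a} → ¬ a <L a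
<L-irrefl (inj₁ p) = <-irrefl refl p
<L-irrefl (inj₂ (_ , p)) = <-irrefl refl p

≮L-same-level : ∀ {a b c} → c ≤ b → ¬ (a , b) <L (a , c)
≮L-same-level c≤b (inj₁ a<a) = <-irrefl refl a<a
≮L-same-level c≤b (inj₂ (_ , b<c)) = <-irrefl refl (<-≤-trans b<c c≤b)

-- Atoms of an interval

module Atoms {n : ℕ} (s : ℕ) where

  Atom : Part n → Part n → Part n → Set
  Atom x y z = InP s z × CoverP s x z × z ≼ y

  data AtomKind (x y z : Part n) : Set where
    signedAtom : ∀ e → zer ∼[ z ] e → ¬ zer ∼[ x ] e → lam x z ≡ (1 , 1) → AtomKind x y z
    coherentAtom : ∀ {i j} (ti : NormRep x i) (tj : NormRep x j) (i<j : toℕ i < toℕ j) →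
                   pos i ∼[ y ] pos j → z ≈ CoherentMerge.merged x ti tj i<j →
                   lam x z ≡ (0 , suc (toℕ j)) → AtomKind x y z
    noncoherentAtom : ∀ {i j} (ti : NormRep x i) (tj : NormRep x j) (i<j : toℕ i < toℕ j) →
                      pos i ∼[ y ] neg j → z ≈ NonCoherentMerge.merged x ti tj i<j →
                      lam x z ≡ (2 , suc (toℕ i)) → AtomKind x y z

  module _ {x y z : Part n} (x∈P : InP s x) (z-atom : Atom x y z) where

    private
      cov : CoverP s x z
      cov = proj₁ (proj₂ z-atom)
      x≼z : x ≼ z
      x≼z = proj₁ (proj₁ cov)
      z≼y : z ≼ y
      z≼y = proj₂ (proj₂ z-atom)

    coherentAtom-of : ∀ {i j} (ti : NormRep x i) (tj : NormRep x j) (i<j : toℕ i < toℕ j) →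
                      pos i ∼[ z ] pos j → lam x z ≡ (0 , suc (toℕ j)) → AtomKind x y z
    coherentAtom-of ti tj i<j r = coherentAtom ti tj i<j (z≼y _ _ r)
      (cover-≈ {x = x} {z} {merged} cov (merged-InP s x∈P) x≼merged merged⋠x (merged-least-pair z x≼z r))
      where open CoherentMerge x ti tj i<j

    noncoherentAtom-of : ∀ {i j} (ti : NormRep x i) (tj : NormRep x j) (i<j : toℕ i < toℕ j) →
                         pos i ∼[ z ] neg j → lam x z ≡ (2 , suc (toℕ i)) → AtomKind x y z
    noncoherentAtom-of ti tj i<j r = noncoherentAtom ti tj i<j (z≼y _ _ r)
      (cover-≈ {x = x} {z} {merged} cov (merged-InP s x∈P) x≼merged merged⋠x (merged-least-pair z x≼z r))
      where open NonCoherentMerge x ti tj i<j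

    atomKind : AtomKind x y z
    atomKind with T? (signedᵇ x z)
    ... | yes t = let e , p , q = signed⁻ {x = x} {z} t in signedAtom e p q (lam-signed {x = x} {z} t)
    ... | no unsigned with unsignedStep {x = x} {z} x≼z (proj₂ (proj₁ cov)) unsigned
    ... | coherent a b ta tb a≢b r eq with <-cmp a b
    ...   | tri< a<b _ _ =
      coherentAtom-of ta tb a<b r (trans eq (cong (λ m → 0 , suc m) (m≤n⇒m⊔n≡n (<⇒≤ a<b))))
    ...   | tri≈ _ a≡b _ = ⊥-elim (a≢b a≡b)
    ...   | tri> _ _ b<a =
      coherentAtom-of tb ta b<a (∼-sym z r) (trans eq (cong (λ m → 0 , suc m) (m≥n⇒m⊔n≡m (<⇒≤ b<a))))
    atomKind | no unsigned | noncoherent a b ta tb a≢b _ r eq with <-cmp a b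
    ...   | tri< a<b _ _ =
      noncoherentAtom-of ta tb a<b r (trans eq (cong (λ m → 2 , suc m) (m≤n⇒m⊓n≡m (<⇒≤ a<b))))
    ...   | tri≈ _ a≡b _ = ⊥-elim (a≢b a≡b)
    ...   | tri> _ _ b<a =
      noncoherentAtom-of tb ta b<a (∼-sym z (∼-neg z r)) (trans eq (cong (λ m → 2 , suc m) (m≥n⇒m⊓n≡n (<⇒≤ b<a))))

  RepPair : Part n → (Fin n → Fin n → Bool) → Fin n → Fin n → Set
  RepPair z joined i j = NormRep z i × NormRep z j × toℕ i < toℕ j × T (joined i j)

  repPair? : ∀ z joined i j → Dec (RepPair z joined i j)
  repPair? z joined i j = T? _ ×-dec T? _ ×-dec toℕ i <? toℕ j ×-dec T? _

  CoherentPair : Part n → Part n → Fin n → Fin n → Set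
  CoherentPair z y = RepPair z (λ i j → rel y (pos i) (pos j))

  NonCoherentPair : Part n → Part n → Fin n → Fin n → Set
  NonCoherentPair z y = RepPair z (λ i j → rel y (pos i) (neg j))

  NoCoherentPair : Part n → Part n → Set
  NoCoherentPair z y = ∀ i j → ¬ CoherentPair z y i j

  coherentPairAt? : ∀ z y j → Dec (∃ λ i → CoherentPair z y i j)
  coherentPairAt? z y j = any? (λ i → repPair? z (λ i j → rel y (pos i) (pos j)) i j)

  noncoherentPairAt? : ∀ z y i → Dec (∃ λ j → NonCoherentPair z y i j)
  noncoherentPairAt? z y i = any? (repPair? z (λ i j → rel y (pos i) (neg j)) i)

  coherentPair-of : ∀ {z y a b} → NormRep z a → NormRep z b → a ≢ b → pos a ∼[ y ] pos b →
                    ∃₂ (CoherentPair z y)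
  coherentPair-of {y = y} {a} {b} ta tb a≢b r with <-cmp a b
  ... | tri< a<b _ _ = a , b , ta , tb , a<b , r
  ... | tri≈ _ a≡b _ = ⊥-elim (a≢b a≡b)
  ... | tri> _ _ b<a = b , a , tb , ta , b<a , ∼-sym y r

  module _ {z y : Part n} (z∈P : InP s z) (z≼y : z ≼ y) where

    coherent-step : ∀ {i j} → CoherentPair z y i j → ∃ λ w → Atom z y w × lam z w ≡ (0 , suc (toℕ j))
    coherent-step (ti , tj , i<j , r) = merged , (merged-InP s z∈P , is-cover s , merged-least-pair y z≼y r) , label
      where open CoherentMerge z ti tj i<j

    noncoherent-step : ∀ {i j} → NonCoherentPair z y i j → ∃ λ w → Atom z y w × lam z w ≡ (2 , suc (toℕ i))
    noncoherent-step (ti , tj , i<j , r) = merged , (merged-InP s z∈P , is-cover s , merged-least-pair y z≼y r) , label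
      where open NonCoherentMerge z ti tj i<j

    noncoherent-step′ : ∀ {a b} → NormRep z a → NormRep z b → a ≢ b → pos a ∼[ y ] neg b →
                        ∃ λ w → Atom z y w × lam z w ≡ (2 , suc (toℕ a ⊓ toℕ b))
    noncoherent-step′ {a} {b} ta tb a≢b r with <-cmp a b
    ... | tri≈ _ a≡b _ = ⊥-elim (a≢b a≡b)
    ... | tri< a<b _ _ = let w , w-atom , eq = noncoherent-step (ta , tb , a<b , r) in
                         w , w-atom , trans eq (cong (λ m → 2 , suc m) (sym (m≤n⇒m⊓n≡m (<⇒≤ a<b))))
    ... | tri> _ _ b<a = let w , w-atom , eq = noncoherent-step (tb , ta , b<a , ∼-sym y (∼-neg y r)) in
                         w , w-atom , trans eq (cong (λ m → 2 , suc m) (sym (m≥n⇒m⊓n≡n (<⇒≤ b<a))))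

  zeroBlock-reaches : ∀ {z y : Part n} {u c} → z ≼ y → zer ∼[ y ] u → RepresentedBy z u c → zer ∼[ y ] pos c
  zeroBlock-reaches {y = y} z≼y r (inj₁ p) = ∼-trans y r (z≼y _ _ p)
  zeroBlock-reaches {y = y} z≼y r (inj₂ p) = zero-∼-neg⁻ y (∼-trans y r (z≼y _ _ p))

  single-pair-outside : ∀ {z y : Part n} → z ≼ y → NoCoherentPair z y → ∀ {e f} →
                        zer ∼[ y ] e → ¬ zer ∼[ z ] e → zer ∼[ y ] f → ¬ zer ∼[ z ] f →
                        e ∼[ z ] f ⊎ negE e ∼[ z ] f
  single-pair-outside {z} {y} z≼y none {e} {f} ye ze yf zf
    with representative z e ze | representative z f zf
  ... | c , tc , e~c | d , td , f~d with c ≟ d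
  ... | no c≢d = let i , j , pair = coherentPair-of {z} {y} tc td c≢d
                                      (∼-trans y (∼-sym y (zeroBlock-reaches {z} {y} z≼y ye e~c))
                                                 (zeroBlock-reaches {z} {y} z≼y yf f~d))
                 in ⊥-elim (none i j pair)
  ... | yes refl = same-rep e~c f~d
    where
    same-rep : RepresentedBy z e c → RepresentedBy z f c → e ∼[ z ] f ⊎ negE e ∼[ z ] f
    same-rep (inj₁ p) (inj₁ q) = inj₁ (∼-trans z p (∼-sym z q))
    same-rep (inj₂ p) (inj₂ q) = inj₁ (∼-trans z p (∼-sym z q))
    same-rep (inj₁ p) (inj₂ q) = inj₂ (∼-trans z (∼-neg z p) (∼-sym z q))
    same-rep (inj₂ p) (inj₁ q) = inj₂ (∼-trans z (∼-neg z p) (∼-sym z q))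

  module AbsorbStep {z y : Part n} (y∈P : InP s y) (z≼y : z ≼ y) (none : NoCoherentPair z y)
                    {e : Elt n} (ye : zer ∼[ y ] e) (ze : ¬ zer ∼[ z ] e) where

    open Absorb z e public

    merged≼y : merged ≼ y
    merged≼y = merged-least-absorb y z≼y ye

    zeroBlock-full : ∀ f → zer ∼[ y ] f → zer ∼[ merged ] f
    zeroBlock-full f yf with T? (rel z zer f)
    ... | yes zf = x≼merged zer f zf
    ... | no zf = of-case (in-S (S⁺ (near-0 (∼-refl z zer)))
                                ([ S⁺ ∘ near-e , S⁺ ∘ near-−e ] (single-pair-outside {z} {y} z≼y none ye ze yf zf)))

    merged-InP : InP s merged
    merged-InP = InP-zeroBlock s {merged} {y} (λ f → merged≼y zer f) zeroBlock-full y∈P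

    atom : Atom z y merged
    atom = merged-InP , covers s ze , merged≼y

    label : lam z merged ≡ (1 , 1)
    label = lam-signed {x = z} {merged} (signed⁺ {x = z} {merged} e zer∼e ze)

  LowLabel : Label → Set
  LowLabel ℓ = proj₁ ℓ ≡ 0 ⊎ ℓ ≡ (1 , 1)

  low-step : ∀ {z y : Part n} → InP s z → InP s y → z ≼ y → ∀ {e} → zer ∼[ y ] e → ¬ zer ∼[ z ] e →
             ∃ λ w → Atom z y w × LowLabel (lam z w)
  low-step {z} {y} z∈P y∈P z≼y ye ze with any? (coherentPairAt? z y)
  ... | yes (j , i , pair) =
    let w , w-atom , eq = coherent-step {z} {y} z∈P z≼y pair in w , w-atom , inj₁ (cong proj₁ eq)
  ... | no none = merged , atom , inj₂ label
    where open AbsorbStep {z} {y} y∈P z≼y (λ i j pair → none (j , i , pair)) ye ze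

  -- A signed cover only enlarges the zero block: otherwise the merge of the two joined
  -- non-zero blocks would lie strictly between x and z.
  signedCover-keeps : ∀ {x z : Part n} → InP s x → CoverP s x z → ∀ {e} → zer ∼[ z ] e → ¬ zer ∼[ x ] e →
                      ∀ {u v} → ¬ zer ∼[ z ] u → u ∼[ z ] v → u ∼[ x ] v
  signedCover-keeps {x} {z} x∈P cov {e} ze xe {u} {v} zu u∼v with T? (rel x u v)
  ... | yes p = p
  ... | no u≁v = ⊥-elim (xe (M.zeroBlock-unchanged zer∉S e (proj₁ z≈M zer e ze)))
    where
    x≼z : x ≼ z
    x≼z = proj₁ (proj₁ cov)
    zv : ¬ zer ∼[ z ] v
    zv r = zu (∼-trans z r (∼-sym z u∼v))
    module M = PairMerge x u v (zu ∘ x≼z zer u ∘ self-neg⇒zero x u) (zv ∘ x≼z zer v ∘ self-neg⇒zero x v)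
                 (λ r → zv (self-neg⇒zero z v (∼-trans z (∼-sym z u∼v) (x≼z u (negE v) r))))
    zer∉S : ¬ T (M.S zer)
    zer∉S s₀ with M.inS s₀
    ... | M.near-a p = zu (x≼z zer u (∼-sym x p))
    ... | M.near-b p = zv (x≼z zer v (∼-sym x p))
    z≈M : z ≈ M.merged
    z≈M = cover-≈ {x = x} {z} {M.merged} cov
            (InP-zeroBlock s {M.merged} {x} (M.zeroBlock-unchanged zer∉S) (λ f → M.x≼merged zer f) x∈P)
            M.x≼merged (λ M≼x → u≁v (M≼x u v M.a∼b)) (M.merged-least-pair z x≼z u∼v)

  normRep-signedCover : ∀ {x z : Part n} → InP s x → CoverP s x z → ∀ {e} → zer ∼[ z ] e → ¬ zer ∼[ x ] e →
                        ∀ {i} → NormRep x i → ¬ zer ∼[ z ] pos i → NormRep z i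
  normRep-signedCover {x} {z} x∈P cov ze xe ti zi =
    normRep-intro z zi λ k k<i → proj₁ (normRep-least x ti k<i) ∘ ∼-sym x ∘ kept (pos k) ,
                                 proj₂ (normRep-least x ti k<i) ∘ ∼-sym x ∘ kept (neg k)
    where
    kept : ∀ c → c ∼[ z ] _ → _
    kept c r = signedCover-keeps {x} {z} x∈P cov ze xe zi (∼-sym z r)

  <L-by : ∀ {ℓ₁ ℓ₂ a b} → ℓ₁ ≡ a → ℓ₂ ≡ b → a <L b → ℓ₁ <L ℓ₂
  <L-by refl refl a<b = a<b

  ≮L-by : ∀ {ℓ₁ ℓ₂ a b} → ℓ₁ ≡ a → ℓ₂ ≡ b → ¬ a <L b → ¬ ℓ₁ <L ℓ₂
  ≮L-by refl refl a≮b = a≮b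

  coherent<other : ∀ {k a b} → (0 , k) <L (suc a , b)
  coherent<other = inj₁ (s≤s z≤n)

  signed<noncoherent : ∀ {k} → (1 , 1) <L (2 , k)
  signed<noncoherent = inj₁ (s≤s (s≤s z≤n))

  other≮coherent : ∀ {a b k} → ¬ (suc a , b) <L (0 , k)
  other≮coherent (inj₁ ())
  other≮coherent (inj₂ (() , _))

  signed≮low : ∀ {ℓ} → LowLabel ℓ → ¬ (1 , 1) <L ℓ
  signed≮low {_ , _} (inj₁ refl) = other≮coherent
  signed≮low (inj₂ refl) = <L-irrefl

  noncoherent≮low : ∀ {ℓ k} → LowLabel ℓ → ¬ (2 , k) <L ℓ
  noncoherent≮low {_ , _} (inj₁ refl) = other≮coherent
  noncoherent≮low (inj₂ refl) (inj₁ (s≤s ()))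
  noncoherent≮low (inj₂ refl) (inj₂ (() , _))

  Falls : Part n → Part n → Part n → Set
  Falls x y z' = ∃ λ w → Atom z' y w × ¬ lam x z' <L lam z' w

  record MinimalAtom (x y : Part n) : Set where
    field
      z : Part n
      z-atom : Atom x y z
      z-least : ∀ z' → Atom x y z' → z' ≈ z ⊎ lam x z <L lam x z'
      z-rises : ∀ w → Atom z y w → lam x z <L lam z w
      others-fall : ∀ z' → Atom x y z' → ¬ z' ≈ z → Falls x y z'

  module CoherentCase {x y : Part n} (x∈P : InP s x) (y∈P : InP s y) (x≼y : x ≼ y)
    {i j : Fin n} (ti : NormRep x i) (tj : NormRep x j) (i<j : toℕ i < toℕ j) (r : pos i ∼[ y ] pos j)
    (least : ∀ j' → toℕ j' < toℕ j → ∀ i' → ¬ CoherentPair x y i' j') where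

    module M = CoherentMerge x ti tj i<j

    z : Part n
    z = M.merged

    z∈P : InP s z
    z∈P = M.merged-InP s x∈P

    z-atom : Atom x y z
    z-atom = z∈P , M.is-cover s , M.merged-least-pair y x≼y r

    normRep-from-z : ∀ {k} → NormRep z k → NormRep x k
    normRep-from-z = normRep-anti {x = x} {z} M.x≼merged

    partner : ∀ {i'} → NormRep x i' → toℕ i' < toℕ j → pos i' ∼[ y ] pos j → i' ≡ i
    partner {i'} ti' i'<j r' with <-cmp i i'
    ... | tri< i<i' _ _ = ⊥-elim (least i' i'<j i (ti , ti' , i<i' , ∼-trans y r (∼-sym y r')))
    ... | tri≈ _ i≡i' _ = sym i≡i'
    ... | tri> _ _ i'<i = ⊥-elim (least i i<j i' (ti' , ti , i'<i , ∼-trans y r' (∼-sym y r)))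

    z-least : ∀ z' → Atom x y z' → z' ≈ z ⊎ lam x z <L lam x z'
    z-least z' at with atomKind {x} {y} {z'} x∈P at
    ... | signedAtom _ _ _ eq = inj₂ (<L-by M.label eq coherent<other)
    ... | noncoherentAtom _ _ _ _ _ eq = inj₂ (<L-by M.label eq coherent<other)
    ... | coherentAtom {i'} {j'} ti' tj' i'<j' r' z'≈ eq with <-cmp j j'
    ...   | tri< j<j' _ _ = inj₂ (<L-by M.label eq (inj₂ (refl , s≤s j<j')))
    ...   | tri> _ _ j'<j = ⊥-elim (least j' j'<j i' (ti' , tj' , i'<j' , r'))
    ...   | tri≈ _ refl _ with partner ti' i'<j' r'
    ...     | refl = inj₁ (≈-trans {x = z'} {CoherentMerge.merged x ti' tj' i'<j'} {z} z'≈
                              (coherentMerge-≈ ti' ti tj' tj i'<j' i<j))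

    z-rises : ∀ w → Atom z y w → lam x z <L lam z w
    z-rises w at with atomKind {z} {y} {w} z∈P at
    ... | signedAtom _ _ _ eq = <L-by M.label eq coherent<other
    ... | noncoherentAtom _ _ _ _ _ eq = <L-by M.label eq coherent<other
    ... | coherentAtom {i'} {j'} ti' tj' i'<j' r' _ eq with <-cmp j j'
    ...   | tri< j<j' _ _ = <L-by M.label eq (inj₂ (refl , s≤s j<j'))
    ...   | tri> _ _ j'<j = ⊥-elim (least j' j'<j i'
                              (normRep-from-z ti' , normRep-from-z tj' , i'<j' , r'))
    ...   | tri≈ _ refl _ = ⊥-elim (proj₁ (normRep-least z tj' i<j) M.a∼b)

    falls-signed : ∀ {z'} → Atom x y z' → ∀ {e} → zer ∼[ z' ] e → ¬ zer ∼[ x ] e →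
                   lam x z' ≡ (1 , 1) → Falls x y z'
    falls-signed {z'} (z'∈P , cov' , z'≼y) {e} ze xe eq
      with T? (rel z' zer (pos i)) | T? (rel z' zer (pos j))
    ... | yes zi | yes zj = ⊥-elim (xe (M.zeroBlock-kept e (proj₁ z'≈z zer e ze)))
      where
      z'≈z : z' ≈ z
      z'≈z = cover-≈ {x = x} {z'} {z} cov' z∈P M.x≼merged M.merged⋠x
               (M.merged-least-pair z' (proj₁ (proj₁ cov')) (∼-trans z' (∼-sym z' zi) zj))
    ... | no zi | no zj =
      let w , w-atom , eq' = coherent-step {z'} {y} z'∈P z'≼y
            (normRep-signedCover {x} {z'} x∈P cov' ze xe ti zi ,
             normRep-signedCover {x} {z'} x∈P cov' ze xe tj zj , i<j , r)
      in w , w-atom , ≮L-by eq eq' other≮coherent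
    ... | yes zi | no zj =
      let w , w-atom , low = low-step {z'} {y} z'∈P y∈P z'≼y (∼-trans y (z'≼y _ _ zi) r) zj
      in w , w-atom , ≮L-by eq refl (signed≮low low)
    ... | no zi | yes zj =
      let w , w-atom , low = low-step {z'} {y} z'∈P y∈P z'≼y (∼-trans y (z'≼y _ _ zj) (∼-sym y r)) zi
      in w , w-atom , ≮L-by eq refl (signed≮low low)

    falls-coherent : ∀ {z' i' j'} → Atom x y z' → ¬ z' ≈ z →
                     (ti' : NormRep x i') (tj' : NormRep x j') (i'<j' : toℕ i' < toℕ j') → pos i' ∼[ y ] pos j' →
                     z' ≈ CoherentMerge.merged x ti' tj' i'<j' → lam x z' ≡ (0 , suc (toℕ j')) → Falls x y z'
    falls-coherent {z'} {i'} {j'} (z'∈P , _ , z'≼y) z'≉z ti' tj' i'<j' r' z'≈ eq with <-cmp j j'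
    ... | tri> _ _ j'<j = ⊥-elim (least j' j'<j i' (ti' , tj' , i'<j' , r'))
    ... | tri≈ _ refl _ with partner ti' i'<j' r'
    ...   | refl = ⊥-elim (z'≉z (≈-trans {x = z'} {CoherentMerge.merged x ti' tj' i'<j'} {z} z'≈
                                    (coherentMerge-≈ ti' ti tj' tj i'<j' i<j)))
    falls-coherent {z'} {i'} {j'} (z'∈P , _ , z'≼y) z'≉z ti' tj' i'<j' r' z'≈ eq | tri< j<j' _ _ =
      let w , w-atom , eq' = coherent-step {z'} {y} z'∈P z'≼y
            (kept ti (<⇒≢ (<-trans i<j j<j')) , kept tj (<⇒≢ j<j') , i<j , r)
      in w , w-atom , ≮L-by eq eq' (≮L-same-level (s≤s (<⇒≤ j<j')))
      where
      kept : ∀ {k} → NormRep x k → k ≢ j' → NormRep z' k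
      kept = CoherentMerge.normRep-kept-below x ti' tj' i'<j' {w = z'} (proj₁ z'≈)

    falls-noncoherent : ∀ {z' i' j'} → Atom x y z' → (∀ {k} → NormRep x k → k ≢ j' → NormRep z' k) →
                        NormRep x i' → toℕ i' < toℕ j' → pos i' ∼[ y ] neg j' →
                        lam x z' ≡ (2 , suc (toℕ i')) → Falls x y z'
    falls-noncoherent {z'} {i'} {j'} (z'∈P , _ , z'≼y) kept ti' i'<j' r' eq with i ≟ j' | j ≟ j'
    ... | no i≢j' | no j≢j' =
      let w , w-atom , eq' = coherent-step {z'} {y} z'∈P z'≼y (kept ti i≢j' , kept tj j≢j' , i<j , r)
      in w , w-atom , ≮L-by eq eq' other≮coherent
    ... | no i≢j' | yes refl with i' ≟ i
    ...   | yes refl =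
      let w , w-atom , low = low-step {z'} {y} z'∈P y∈P z'≼y
            (self-neg⇒zero y (pos i) (∼-trans y r' (∼-neg y (∼-sym y r)))) (normRep-nonzero z' (kept ti i≢j'))
      in w , w-atom , ≮L-by eq refl (noncoherent≮low low)
    ...   | no i'≢i =
      let w , w-atom , eq' = noncoherent-step′ {z'} {y} z'∈P z'≼y (kept ti' (<⇒≢ i'<j')) (kept ti i≢j') i'≢i
                               (∼-trans y r' (∼-neg y (∼-sym y r)))
      in w , w-atom , ≮L-by eq eq' (≮L-same-level (s≤s (m⊓n≤m _ _)))
    falls-noncoherent {z'} {i'} (z'∈P , _ , z'≼y) kept ti' i'<j' r' eq | yes refl | _ =
      let w , w-atom , eq' = noncoherent-step′ {z'} {y} z'∈P z'≼y (kept ti' (<⇒≢ i'<j')) (kept tj (<⇒≢ i<j ∘ sym))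
                               (<⇒≢ (<-trans i'<j' i<j)) (∼-trans y r' (∼-neg y r))
      in w , w-atom , ≮L-by eq eq' (≮L-same-level (s≤s (m⊓n≤m _ _)))

    others-fall : ∀ z' → Atom x y z' → ¬ z' ≈ z → Falls x y z'
    others-fall z' at z'≉z with atomKind {x} {y} {z'} x∈P at
    ... | signedAtom e p q eq = falls-signed at p q eq
    ... | coherentAtom ti' tj' i'<j' r' z'≈ eq = falls-coherent at z'≉z ti' tj' i'<j' r' z'≈ eq
    ... | noncoherentAtom ti' tj' i'<j' r' z'≈ eq =
      falls-noncoherent at (NonCoherentMerge.normRep-kept-below x ti' tj' i'<j' {w = z'} (proj₁ z'≈)) ti' i'<j' r' eq

    result : MinimalAtom x y
    result = record { z = z ; z-atom = z-atom ; z-least = z-least ; z-rises = z-rises ; others-fall = others-fall }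

  module SignedCase {x y : Part n} (x∈P : InP s x) (y∈P : InP s y) (x≼y : x ≼ y) (none : NoCoherentPair x y)
                    {e : Elt n} (ye : zer ∼[ y ] e) (xe : ¬ zer ∼[ x ] e) where

    module A = AbsorbStep {x} {y} y∈P x≼y none ye xe

    z : Part n
    z = A.merged

    signed-atom-≈ : ∀ {z'} → Atom x y z' → ∀ {e'} → zer ∼[ z' ] e' → ¬ zer ∼[ x ] e' → z' ≈ z
    signed-atom-≈ {z'} (_ , cov' , z'≼y) {e'} z'e' xe' =
      cover-≈ {x = x} {z'} {z} cov' A.merged-InP A.x≼merged (λ z≼x → xe (z≼x zer e A.zer∼e))
        (A.merged-least-absorb z' x≼z' ([ through , zero-∼-neg⁻ z' ∘ through ]
                                          (single-pair-outside {x} {y} x≼y none ye xe (z'≼y zer e' z'e') xe')))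
      where
      x≼z' : x ≼ z'
      x≼z' = proj₁ (proj₁ cov')
      through : ∀ {c} → c ∼[ x ] e' → zer ∼[ z' ] c
      through h = ∼-trans z' z'e' (x≼z' _ _ (∼-sym x h))

    z-least : ∀ z' → Atom x y z' → z' ≈ z ⊎ lam x z <L lam x z'
    z-least z' at with atomKind {x} {y} {z'} x∈P at
    ... | signedAtom _ p q _ = inj₁ (signed-atom-≈ {z'} at p q)
    ... | coherentAtom ti tj i<j r _ _ = ⊥-elim (none _ _ (ti , tj , i<j , r))
    ... | noncoherentAtom _ _ _ _ _ eq = inj₂ (<L-by A.label eq signed<noncoherent)

    z-rises : ∀ w → Atom z y w → lam x z <L lam z w
    z-rises w at@(_ , _ , w≼y) with atomKind {z} {y} {w} A.merged-InP at
    ... | signedAtom e' p q _ = ⊥-elim (q (A.zeroBlock-full e' (w≼y zer e' p)))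
    ... | coherentAtom ti tj i<j r _ _ =
      ⊥-elim (none _ _ (normRep-anti {x = x} {z} A.x≼merged ti , normRep-anti {x = x} {z} A.x≼merged tj , i<j , r))
    ... | noncoherentAtom _ _ _ _ _ eq = <L-by A.label eq signed<noncoherent

    others-fall : ∀ z' → Atom x y z' → ¬ z' ≈ z → Falls x y z'
    others-fall z' at@(z'∈P , _ , z'≼y) z'≉z with atomKind {x} {y} {z'} x∈P at
    ... | signedAtom _ p q _ = ⊥-elim (z'≉z (signed-atom-≈ {z'} at p q))
    ... | coherentAtom ti tj i<j r _ _ = ⊥-elim (none _ _ (ti , tj , i<j , r))
    ... | noncoherentAtom ti tj i<j _ z'≈ eq =
      let w , w-atom , low = low-step {z'} {y} z'∈P y∈P z'≼y ye
                               (xe ∘ NonCoherentMerge.zeroBlock-kept x ti tj i<j e ∘ proj₁ z'≈ zer e)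
      in w , w-atom , ≮L-by eq refl (noncoherent≮low low)

    result : MinimalAtom x y
    result = record { z = z ; z-atom = A.atom ; z-least = z-least ; z-rises = z-rises ; others-fall = others-fall }

  module NonCoherentCase {x y : Part n} (x∈P : InP s x) (y∈P : InP s y) (x≼y : x ≼ y) (none : NoCoherentPair x y)
    (y₀⊆x₀ : ∀ f → zer ∼[ y ] f → zer ∼[ x ] f)
    {i j : Fin n} (ti : NormRep x i) (tj : NormRep x j) (i<j : toℕ i < toℕ j) (r : pos i ∼[ y ] neg j)
    (least : ∀ i' → toℕ i' < toℕ i → ∀ j' → ¬ NonCoherentPair x y i' j') where

    module M = NonCoherentMerge x ti tj i<j

    z : Part n
    z = M.merged

    z∈P : InP s z
    z∈P = M.merged-InP s x∈P

    z-atom : Atom x y z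
    z-atom = z∈P , M.is-cover s , M.merged-least-pair y x≼y r

    normRep-from-z : ∀ {k} → NormRep z k → NormRep x k
    normRep-from-z = normRep-anti {x = x} {z} M.x≼merged

    partner : ∀ {b} → NormRep x b → pos i ∼[ y ] neg b → b ≡ j
    partner {b} tb r' with b ≟ j
    ... | yes b≡j = b≡j
    ... | no b≢j =
      let i' , j' , pair = coherentPair-of {x} {y} tj tb (b≢j ∘ sym) (∼-neg⁻ y (∼-trans y (∼-sym y r) r'))
      in ⊥-elim (none i' j' pair)

    z-least : ∀ z' → Atom x y z' → z' ≈ z ⊎ lam x z <L lam x z'
    z-least z' at@(_ , _ , z'≼y) with atomKind {x} {y} {z'} x∈P at
    ... | signedAtom e p q _ = ⊥-elim (q (y₀⊆x₀ e (z'≼y zer e p)))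
    ... | coherentAtom ti' tj' i'<j' r' _ _ = ⊥-elim (none _ _ (ti' , tj' , i'<j' , r'))
    ... | noncoherentAtom {i'} {j'} ti' tj' i'<j' r' z'≈ eq with <-cmp i i'
    ...   | tri< i<i' _ _ = inj₂ (<L-by M.label eq (inj₂ (refl , s≤s i<i')))
    ...   | tri> _ _ i'<i = ⊥-elim (least i' i'<i j' (ti' , tj' , i'<j' , r'))
    ...   | tri≈ _ refl _ with partner tj' r'
    ...     | refl = inj₁ (≈-trans {x = z'} {NonCoherentMerge.merged x ti' tj' i'<j'} {z} z'≈
                              (nonCoherentMerge-≈ ti' ti tj' tj i'<j' i<j))

    z-rises : ∀ w → Atom z y w → lam x z <L lam z w
    z-rises w at@(_ , _ , w≼y) with atomKind {z} {y} {w} z∈P at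
    ... | signedAtom e p q _ = ⊥-elim (q (M.x≼merged zer e (y₀⊆x₀ e (w≼y zer e p))))
    ... | coherentAtom ti' tj' i'<j' r' _ _ =
      ⊥-elim (none _ _ (normRep-from-z ti' , normRep-from-z tj' , i'<j' , r'))
    ... | noncoherentAtom {i'} {j'} ti' tj' i'<j' r' _ eq with <-cmp i i'
    ...   | tri< i<i' _ _ = <L-by M.label eq (inj₂ (refl , s≤s i<i'))
    ...   | tri> _ _ i'<i = ⊥-elim (least i' i'<i j'
                              (normRep-from-z ti' , normRep-from-z tj' , i'<j' , r'))
    ...   | tri≈ _ refl _ with partner (normRep-from-z tj') r'
    ...     | refl = ⊥-elim (proj₂ (normRep-least z tj' i<j) (∼-neg z M.a∼b))

    others-fall : ∀ z' → Atom x y z' → ¬ z' ≈ z → Falls x y z'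
    others-fall z' at@(z'∈P , _ , z'≼y) z'≉z with atomKind {x} {y} {z'} x∈P at
    ... | signedAtom e p q _ = ⊥-elim (q (y₀⊆x₀ e (z'≼y zer e p)))
    ... | coherentAtom ti' tj' i'<j' r' _ _ = ⊥-elim (none _ _ (ti' , tj' , i'<j' , r'))
    ... | noncoherentAtom {i'} {j'} ti' tj' i'<j' r' z'≈ eq with <-cmp i i'
    ...   | tri> _ _ i'<i = ⊥-elim (least i' i'<i j' (ti' , tj' , i'<j' , r'))
    ...   | tri≈ _ refl _ with partner tj' r'
    ...     | refl = ⊥-elim (z'≉z (≈-trans {x = z'} {NonCoherentMerge.merged x ti' tj' i'<j'} {z} z'≈
                                      (nonCoherentMerge-≈ ti' ti tj' tj i'<j' i<j)))
    others-fall z' at@(z'∈P , _ , z'≼y) z'≉z | noncoherentAtom {i'} {j'} ti' tj' i'<j' r' z'≈ eq | tri< i<i' _ _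
      with j ≟ j'
    ... | yes refl =
      let a , b , pair = coherentPair-of {x} {y} ti ti' (<⇒≢ i<i') (∼-trans y r (∼-sym y r')) in ⊥-elim (none a b pair)
    ... | no j≢j' =
      let w , w-atom , eq' = noncoherent-step {z'} {y} z'∈P z'≼y
            (kept ti (<⇒≢ (<-trans i<i' i'<j')) , kept tj j≢j' , i<j , r)
      in w , w-atom , ≮L-by eq eq' (≮L-same-level (s≤s (<⇒≤ i<i')))
      where
      kept : ∀ {k} → NormRep x k → k ≢ j' → NormRep z' k
      kept = NonCoherentMerge.normRep-kept-below x ti' tj' i'<j' {w = z'} (proj₁ z'≈)

    result : MinimalAtom x y
    result = record { z = z ; z-atom = z-atom ; z-least = z-least ; z-rises = z-rises ; others-fall = others-fall }

  noncoherentPair-exists : ∀ {x y : Part n} → x ≼ y → ¬ y ≼ x → NoCoherentPair x y →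
                           (∀ f → zer ∼[ y ] f → zer ∼[ x ] f) → ∃₂ (NonCoherentPair x y)
  noncoherentPair-exists {x} {y} x≼y y⋠x none y₀⊆x₀
    with unsigned-candidate {x = x} {y} x≼y y⋠x
           (λ t → let e , p , q = signed⁻ {x = x} {y} t in q (y₀⊆x₀ e p))
  ... | (a , b) , c with candidate⁻ {x = x} {y} c
  ... | ta , tb , a≢b , inj₁ r = ⊥-elim (let i , j , pair = coherentPair-of {x} {y} ta tb a≢b r in none i j pair)
  ... | ta , tb , a≢b , inj₂ r with <-cmp a b
  ...   | tri< a<b _ _ = a , b , ta , tb , a<b , r
  ...   | tri≈ _ a≡b _ = ⊥-elim (a≢b a≡b)
  ...   | tri> _ _ b<a = b , a , tb , ta , b<a , ∼-sym y (∼-neg y r)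

  minimalAtom : ∀ {x y : Part n} → InP s x → InP s y → x ≼ y → ¬ y ≼ x → MinimalAtom x y
  minimalAtom {x} {y} x∈P y∈P x≼y y⋠x with any? (coherentPairAt? x y)
  ... | yes found with leastFin _ (coherentPairAt? x y) found
  ...   | j , (i , ti , tj , i<j , r) , least =
    CoherentCase.result x∈P y∈P x≼y ti tj i<j r (λ j' j'<j i' pair → least j' j'<j (i' , pair))
  minimalAtom {x} {y} x∈P y∈P x≼y y⋠x | no ¬found with inherits-or-separated y x zer
  ... | inj₂ (e , ye , xe) = SignedCase.result x∈P y∈P x≼y (λ i j pair → ¬found (j , i , pair)) ye xe
  ... | inj₁ y₀⊆x₀ with noncoherentPair-exists {x} {y} x≼y y⋠x (λ i j pair → ¬found (j , i , pair)) y₀⊆x₀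
  ...   | i₀ , j₀ , pair with leastFin _ (noncoherentPairAt? x y) (i₀ , j₀ , pair)
  ...     | i , (j , ti , tj , i<j , r) , least =
    NonCoherentCase.result x∈P y∈P x≼y (λ i j pair → ¬found (j , i , pair)) y₀⊆x₀ ti tj i<j r
      (λ i' i'<i j' pair → least i' i'<i (j' , pair))

-- The induction

module _ {n : ℕ} where

  unrelatedPairs : Part n → List (Elt n × Elt n) → ℕ
  unrelatedPairs x [] = 0
  unrelatedPairs x ((a , b) ∷ ps) = (if rel x a b then 0 else 1) + unrelatedPairs x ps

  private
    indicator-mono : ∀ {p q} → (T p → T q) → (if q then 0 else 1) ≤ (if p then 0 else 1)
    indicator-mono {true} {true} _ = z≤n
    indicator-mono {true} {false} p⇒q = ⊥-elim (p⇒q tt)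
    indicator-mono {false} {true} _ = z≤n
    indicator-mono {false} {false} _ = s≤s z≤n

  unrelatedPairs-mono : ∀ {x z} ps → x ≼ z → unrelatedPairs z ps ≤ unrelatedPairs x ps
  unrelatedPairs-mono [] x≼z = z≤n
  unrelatedPairs-mono ((a , b) ∷ ps) x≼z = +-mono-≤ (indicator-mono (x≼z a b)) (unrelatedPairs-mono ps x≼z)

  unrelatedPairs-strict : ∀ {x z a b} ps → x ≼ z → (a , b) ∈ ps → a ∼[ z ] b → ¬ a ∼[ x ] b →
                          unrelatedPairs z ps < unrelatedPairs x ps
  unrelatedPairs-strict {x} {z} ((a , b) ∷ ps) x≼z (here refl) a∼b a≁b with rel z a b | rel x a b
  ... | true | false = +-mono-<-≤ (s≤s z≤n) (unrelatedPairs-mono ps x≼z)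
  ... | false | _ = ⊥-elim a∼b
  ... | true | true = ⊥-elim (a≁b tt)
  unrelatedPairs-strict ((a' , b') ∷ ps) x≼z (there ab∈ps) a∼b a≁b =
    +-mono-≤-< (indicator-mono (x≼z a' b')) (unrelatedPairs-strict ps x≼z ab∈ps a∼b a≁b)

  separation : Part n → ℕ
  separation x = unrelatedPairs x (cartesianProduct (allElt n) (allElt n))

  separation-decreases : ∀ {x z} → x ≼ z → ¬ z ≼ x → separation z < separation x
  separation-decreases {x} {z} x≼z z⋠x with ≼-or-separated z x
  ... | inj₁ z≼x = ⊥-elim (z⋠x z≼x)
  ... | inj₂ (a , b , a∼b , a≁b) =
    unrelatedPairs-strict _ x≼z (∈-cartesianProduct⁺ (∈-allElt a) (∈-allElt b)) a∼b a≁b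

module ELInduction {n : ℕ} (s : ℕ) where

  open Atoms {n} s

  chain-≼ : ∀ {x y : Part n} → Chain s x y → x ≼ y
  chain-≼ (done x≈y) = proj₁ x≈y
  chain-≼ {x} {y} (step {z = z} _ cov c) = ≼-trans {x = x} {z} {y} (proj₁ (proj₁ cov)) (chain-≼ c)

  cover-respˡ : ∀ {x x' z : Part n} → x' ≈ x → CoverP s x z → CoverP s x' z
  cover-respˡ {x} {x'} {z} x'≈x ((x≼z , z⋠x) , between) =
    (≼-trans {x = x'} {x} {z} (proj₁ x'≈x) x≼z , (λ z≼x' → z⋠x (≼-trans {x = z} {x'} {x} z≼x' (proj₁ x'≈x)))) ,
    between'
    where
    between' : ∀ w → InP s w → x' ≼ w → w ≼ z → w ≈ x' ⊎ w ≈ z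
    between' w w∈P x'≼w w≼z with between w w∈P (≼-trans {x = x} {x'} {w} (proj₂ x'≈x) x'≼w) w≼z
    ... | inj₁ w≈x = inj₁ (≈-trans {x = w} {x} {x'} w≈x (≈-sym {x = x'} {x} x'≈x))
    ... | inj₂ w≈z = inj₂ w≈z

  rebase : ∀ {x x' y : Part n} → x' ≈ x → Chain s x y → Chain s x' y
  rebase {x} {x'} {y} x'≈x (done x≈y) = done (≈-trans {x = x'} {x} {y} x'≈x x≈y)
  rebase {x} {x'} x'≈x (step {z = z} z∈P cov c) = step z∈P (cover-respˡ {x} {x'} {z} x'≈x cov) c

  labels-rebase : ∀ {x x' y : Part n} (x'≈x : x' ≈ x) (c : Chain s x y) →
                  labels (rebase {x} {x'} {y} x'≈x c) ≡ labels c
  labels-rebase x'≈x (done _) = refl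
  labels-rebase {x} {x'} x'≈x (step {z = z} _ _ c) =
    cong (_∷ labels c) (lam-cong {x = x'} {x} {z} {z} x'≈x (≈-refl {x = z}))

  ChainEq-refl : ∀ {x y : Part n} (c : Chain s x y) → ChainEq c c
  ChainEq-refl (done _) = tt
  ChainEq-refl (step {z = z} _ _ c) = ≈-refl {x = z} , ChainEq-refl c

  ChainEq-rebase : ∀ {x x' y : Part n} (x'≈x : x' ≈ x) (c : Chain s x y) → ChainEq (rebase {x} {x'} {y} x'≈x c) c
  ChainEq-rebase x'≈x (done _) = tt
  ChainEq-rebase x'≈x (step {z = z} _ _ c) = ≈-refl {x = z} , ChainEq-refl c

  ChainEq-trans : ∀ {a b c d e f : Part n} (c₁ : Chain s a b) (c₂ : Chain s c d) (c₃ : Chain s e f) →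
                  ChainEq c₁ c₂ → ChainEq c₂ c₃ → ChainEq c₁ c₃
  ChainEq-trans (done _) (done _) (done _) _ _ = tt
  ChainEq-trans (step {z = z₁} _ _ c₁) (step {z = z₂} _ _ c₂) (step {z = z₃} _ _ c₃)
                (z₁≈z₂ , e₁₂) (z₂≈z₃ , e₂₃) =
    ≈-trans {x = z₁} {z₂} {z₃} z₁≈z₂ z₂≈z₃ , ChainEq-trans c₁ c₂ c₃ e₁₂ e₂₃

  IsELChain : ∀ {x y : Part n} → Chain s x y → Set
  IsELChain {x} {y} c = Increasing (labels c) ×
    (∀ (c' : Chain s x y) → (Increasing (labels c') → ChainEq c c') ×
                            (¬ ChainEq c c' → LexLt (labels c) (labels c')))

  StartsMinimal : ∀ {x y : Part n} → Chain s x y → Set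
  StartsMinimal (done _) = ⊤
  StartsMinimal {x} {y} (step {z = z} _ _ _) = ∀ w → Atom x y w → w ≈ z ⊎ lam x z <L lam x w

  ELWitness : Part n → Part n → Set
  ELWitness x y = Σ (Chain s x y) λ c → IsELChain c × StartsMinimal c

  trivial-witness : ∀ {x y : Part n} → x ≼ y → y ≼ x → ELWitness x y
  trivial-witness {x} {y} x≼y y≼x = done (x≼y , y≼x) , ([] , compare) , tt
    where
    compare : ∀ c' → (Increasing (labels c') → ChainEq (done {s = s} (x≼y , y≼x)) c') ×
                     (¬ ChainEq (done {s = s} (x≼y , y≼x)) c' → LexLt [] (labels c'))
    compare (done _) = (λ _ → tt) , (λ ne → ⊥-elim (ne tt))
    compare (step {z = w} _ cov c) = ⊥-elim (proj₂ (proj₁ cov) (≼-trans {x = w} {y} {x} (chain-≼ c) y≼x))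

  -- The label after z' on an increasing chain would lie below that of the lexicographically
  -- first atom of [z', y], which does not exceed λ(z', w).
  falls-not-increasing : ∀ {x z' y : Part n} → Falls x y z' → ELWitness z' y →
                         (c : Chain s z' y) → ¬ Increasing (lam x z' ∷ labels c)
  falls-not-increasing {z' = z'} {y} (w , (_ , cov , w≼y) , _) _ (done z'≈y) _ =
    proj₂ (proj₁ cov) (≼-trans {x = w} {y} {z'} w≼y (proj₂ z'≈y))
  falls-not-increasing {x} {z'} {y} (w , w-atom , z'≮w) (c₀ , (_ , unique) , starts₀)
                       c@(step {z = w₁} _ _ _) inc@(z'<w₁ ∷ _) =
    first-atom c₀ starts₀ (proj₁ (unique c) (tail inc))
    where
    first-atom : (d : Chain s z' y) → StartsMinimal d → ChainEq d c → ⊥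
    first-atom (step {z = w₀} _ _ _) starts (w₀≈w₁ , _) with starts w w-atom
    ... | inj₁ w≈w₀ = z'≮w (subst (lam x z' <L_) (lam-cong {x = z'} {z'} {w₁} {w} (≈-refl {x = z'})
                             (≈-sym {x = w} {w₁} (≈-trans {x = w} {w₀} {w₁} w≈w₀ w₀≈w₁))) z'<w₁)
    ... | inj₂ w₀<w = z'≮w (<L-trans (subst (lam x z' <L_) (lam-cong {x = z'} {z'} {w₁} {w₀} (≈-refl {x = z'})
                             (≈-sym {x = w₀} {w₁} w₀≈w₁)) z'<w₁) w₀<w)

  extend : ∀ {x y : Part n} → ¬ y ≼ x → MinimalAtom x y →
           (∀ z' → Atom x y z' → ELWitness z' y) → ELWitness x y
  extend {x} {y} y⋠x m ih = step z∈P cov c₀ , (increasing c₀ inc₀ , compare) , z-least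
    where
    open MinimalAtom m
    z∈P : InP s z
    z∈P = proj₁ z-atom
    cov : CoverP s x z
    cov = proj₁ (proj₂ z-atom)
    c₀ : Chain s z y
    c₀ = proj₁ (ih z z-atom)
    inc₀ : Increasing (labels c₀)
    inc₀ = proj₁ (proj₁ (proj₂ (ih z z-atom)))
    unique₀ : ∀ c' → (Increasing (labels c') → ChainEq c₀ c') ×
                     (¬ ChainEq c₀ c' → LexLt (labels c₀) (labels c'))
    unique₀ = proj₂ (proj₁ (proj₂ (ih z z-atom)))

    increasing : (d : Chain s z y) → Increasing (labels d) → Increasing (lam x z ∷ labels d)
    increasing (done _) _ = [-]
    increasing (step {z = w} w∈P cov-w d) inc = z-rises w (w∈P , cov-w , chain-≼ d) ∷ inc

    compare : (c' : Chain s x y) → (Increasing (labels c') → ChainEq (step z∈P cov c₀) c') ×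
                                   (¬ ChainEq (step z∈P cov c₀) c' → LexLt (lam x z ∷ labels c₀) (labels c'))
    compare (done x≈y) = ⊥-elim (y⋠x (proj₂ x≈y))
    compare (step {z = z'} z'∈P cov' c') with z-least z' (z'∈P , cov' , chain-≼ c')
    ... | inj₂ z<z' = (λ inc → ⊥-elim (falls-not-increasing (others-fall z' (z'∈P , cov' , chain-≼ c') z'≉z)
                                         (ih z' (z'∈P , cov' , chain-≼ c')) c' inc)) ,
                      (λ _ → inj₁ z<z')
      where
      z'≉z : ¬ z' ≈ z
      z'≉z z'≈z = <L-irrefl (subst (lam x z <L_) (lam-cong {x = x} {x} {z'} {z} (≈-refl {x = x}) z'≈z) z<z')
    ... | inj₁ z'≈z =
      (λ inc → z≈z' , via-rebased (proj₁ (unique₀ rebased) (subst Increasing (sym same-labels) (tail inc)))) ,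
      (λ ne → inj₂ (lam-cong {x = x} {x} {z} {z'} (≈-refl {x = x}) z≈z' ,
                    subst (LexLt (labels c₀)) same-labels (proj₂ (unique₀ rebased) (ne ∘ (z≈z' ,_) ∘ via-rebased))))
      where
      z≈z' : z ≈ z'
      z≈z' = ≈-sym {x = z'} {z} z'≈z
      rebased : Chain s z y
      rebased = rebase z≈z' c'
      same-labels : labels rebased ≡ labels c'
      same-labels = labels-rebase z≈z' c'
      via-rebased : ChainEq c₀ rebased → ChainEq c₀ c'
      via-rebased e = ChainEq-trans c₀ rebased c' e (ChainEq-rebase z≈z' c')

  el-witness : ∀ (x y : Part n) → InP s x → InP s y → x ≼ y → Acc _<_ (separation x) → ELWitness x y
  el-witness x y x∈P y∈P x≼y (acc smaller) with ≼-or-separated y x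
  ... | inj₁ y≼x = trivial-witness x≼y y≼x
  ... | inj₂ (u , v , u∼v , u≁v) = extend y⋠x (minimalAtom x∈P y∈P x≼y y⋠x) above
    where
    y⋠x : ¬ y ≼ x
    y⋠x y≼x = u≁v (y≼x u v u∼v)
    above : ∀ z' → Atom x y z' → ELWitness z' y
    above z' (z'∈P , ((x≼z' , z'⋠x) , _) , z'≼y) =
      el-witness z' y z'∈P y∈P z'≼y (smaller (separation-decreases x≼z' z'⋠x))

theorem4p23 : (n s : ℕ) → s ≤ n → IsELLabeling n s
theorem4p23 n s _ x y x∈P y∈P x≼y =
  let c , el-chain , _ = ELInduction.el-witness s x y x∈P y∈P x≼y (<-wellFounded _) in c , el-chain
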